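{- Let $q$ be a prime power and let $C$ be a Singer cycle of ${\rm GL}(3,q)$. For $0\le i\le q^2+q$ let $\mathcal Q_i$ be the quadric of ${\rm PG}(5,q)$ with quadratic form $\mathbf Q_i(\mathbf X)=XC^iY^T$, where $\mathbf X=(X_1,\dots,X_6)$, $X=(X_1,X_2,X_3)$, $Y=(X_4,X_5,X_6)$. Let $\pi_1: X_1=X_2=X_3=0$ and $\pi_2: X_4=X_5=X_6=0$. For each $i$, let $\mathcal G_i$ be the set of planes contained in $\mathcal Q_i$ which belong to the same family (class) of planes of $\mathcal Q_i$ as $\pi_1$, are distinct from $\pi_1$, and are disjoint from $\pi_2$ (there are $q^3-1$ of them). Then $\mathcal C=\bigcup_{i=0}^{q^2+q}\mathcal G_i$ is a $(6,(q^3-1)(q^2+q+1),4;3)_q$ constant-dimension subspace code; that is, $\mathcal C$ consists of $(q^3-1)(q^2+q+1)$ planes of ${\rm PG}(5,q)$, any two of which meet in at most one point.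
   Context: A Singer cycle of ${\rm GL}(3,q)$ is an element of order $q^3-1$ acting transitively on the nonzero vectors of ${\rm GF}(q)^3$. Each $\mathcal Q_i$ is a non-degenerate hyperbolic (Klein) quadric of ${\rm PG}(5,q)$ containing the disjoint planes $\pi_1,\pi_2$; the planes of a hyperbolic quadric $\mathcal Q^+(5,q)$ fall into two families (Greek and Latin) of $(q+1)(q^2+1)$ planes each, two planes of the same family meeting in exactly a point; $\pi_1$ and $\pi_2$ lie in different families of each $\mathcal Q_i$. An $(n,M,2\delta;k)_q$ constant-dimension code is a set of $M$ $k$-dimensional subspaces of ${\rm GF}(q)^n$ with minimum subspace distance $2\delta$, where $d(U,U')=\dim(U+U')-\dim(U\cap U')$. -}

module Defs where

open import Level using (0ℓ)
open import Data.Nat using (ℕ; zero; suc; _<_)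
open import Data.Fin using (Fin; zero; suc)
open import Data.Product using (Σ; _×_; _,_; ∃)
open import Data.Sum using (_⊎_)
open import Data.List using (List)
open import Data.List.Membership.Propositional using (_∈_)
open import Data.List.Relation.Unary.Unique.Propositional using (Unique)
open import Relation.Nullary using (¬_; Dec)
open import Relation.Binary.PropositionalEquality using (_≡_; _≢_)
open import Algebra.Structures using (IsCommutativeRing)

-- The order q of a finite field is the length of a duplicate-free list
-- enumerating all its elements; q is then automatically a prime power,
-- and every prime power arises (GF(q)), so quantifying over all finite
-- fields of order q is quantifying over "q a prime power, GF(q)".

record FiniteField : Set₁ where
  infixl 6 _+_
  infixl 7 _*_
  field
    Carrier  : Set
    _+_ _*_  : Carrier → Carrier → Carrier
    -_       : Carrier → Carrier
    0# 1#    : Carrier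
    isCommutativeRing : IsCommutativeRing _≡_ _+_ _*_ -_ 0# 1#
    0≢1      : 0# ≢ 1#
    inverse  : ∀ x → x ≢ 0# → Σ Carrier (λ y → x * y ≡ 1#)
    _≟_      : (x y : Carrier) → Dec (x ≡ y)
    elements : List Carrier
    unique   : Unique elements
    complete : ∀ x → x ∈ elements

module LinAlg (F : FiniteField) where
  open FiniteField F public

  Σ[_] : (n : ℕ) → (Fin n → Carrier) → Carrier
  Σ[ zero ] f = 0#
  Σ[ suc n ] f = f zero + Σ[ n ] (λ i → f (suc i))

  Vec : ℕ → Set
  Vec n = Fin n → Carrier

  zeroV : ∀ {n} → Vec n
  zeroV _ = 0#

  IsZero : ∀ {n} → Vec n → Set
  IsZero v = ∀ j → v j ≡ 0#

  NonZero : ∀ {n} → Vec n → Set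
  NonZero v = ¬ IsZero v

  Mat3 : Set
  Mat3 = Fin 3 → Fin 3 → Carrier

  _⊗_ : Mat3 → Mat3 → Mat3
  (A ⊗ B) j k = Σ[ 3 ] (λ l → A j l * B l k)

  I3 : Mat3
  I3 zero    zero          = 1#
  I3 (suc a) (suc b)       = I3' a b
    where
    I3' : Fin 2 → Fin 2 → Carrier
    I3' zero zero = 1#
    I3' (suc zero) (suc zero) = 1#
    I3' _ _ = 0#
  I3 _ _ = 0#

  _^_ : Mat3 → ℕ → Mat3
  A ^ zero  = I3
  A ^ suc n = A ⊗ (A ^ n)

  _·M_ : Vec 3 → Mat3 → Vec 3
  (x ·M A) k = Σ[ 3 ] (λ j → x j * A j k)

  MatEq : Mat3 → Mat3 → Set
  MatEq A B = ∀ j k → A j k ≡ B j k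

  q : ℕ
  q = Data.List.length elements

  record SingerCycle (C : Mat3) : Set where
    field
      order-divides : MatEq (C ^ (q Data.Nat.^ 3 Data.Nat.∸ 1)) I3
      order-exact   : ∀ k → 0 < k → k < q Data.Nat.^ 3 Data.Nat.∸ 1 → ¬ MatEq (C ^ k) I3
      transitive    : ∀ (u v : Vec 3) → NonZero u → NonZero v →
                      Σ ℕ (λ k → ∀ j → (u ·M (C ^ k)) j ≡ v j)

  Xpart : Vec 6 → Vec 3
  Xpart v j = v (j Data.Fin.↑ˡ 3)

  Ypart : Vec 6 → Vec 3
  Ypart v j = v (3 Data.Fin.↑ʳ j)

  Qform : Mat3 → ℕ → Vec 6 → Carrier
  Qform C i v = Σ[ 3 ] (λ j → Σ[ 3 ] (λ k → Xpart v j * (C ^ i) j k * Ypart v k))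

  comb : (Fin 3 → Carrier) → (Fin 3 → Vec 6) → Vec 6
  comb c b m = Σ[ 3 ] (λ j → c j * b j m)

  Sub : Set₁
  Sub = Vec 6 → Set

  -- a plane of PG(5,q) = 3-dimensional subspace of GF(q)^6,
  -- given by a linearly independent basis
  record Plane : Set where
    field
      basis       : Fin 3 → Vec 6
      independent : ∀ c → IsZero (comb c basis) → ∀ j → c j ≡ 0#

  ⟪_⟫ : Plane → Sub
  ⟪ W ⟫ v = Σ (Fin 3 → Carrier) (λ c → ∀ m → comb c (Plane.basis W) m ≡ v m)

  _≐_ : Sub → Sub → Set
  U ≐ W = ∀ v → (U v → W v) × (W v → U v)

  -- U ∩ W has (vector) dimension ≤ 1: any two common vectors are
  -- linearly dependent ("meet in at most one point")
  AtMostPoint : Sub → Sub → Set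
  AtMostPoint U W = ∀ u v → U u → W u → U v → W v →
    Σ Carrier (λ a → Σ Carrier (λ b → (¬ (a ≡ 0# × b ≡ 0#)) ×
      (∀ m → a * u m + b * v m ≡ 0#)))

  ExactlyPoint : Sub → Sub → Set
  ExactlyPoint U W = Σ (Vec 6) (λ u → U u × W u × NonZero u) × AtMostPoint U W

  Disjoint : Sub → Sub → Set
  Disjoint U W = ∀ v → U v → W v → IsZero v

  π₁ : Sub
  π₁ v = IsZero (Xpart v)

  π₂ : Sub
  π₂ v = IsZero (Ypart v)

  InQuadric : Mat3 → ℕ → Sub → Set
  InQuadric C i U = ∀ v → U v → Qform C i v ≡ 0#

  -- two planes of a hyperbolic quadric Q⁺(5,q) belong to the same family
  -- iff they coincide or meet in exactly a point
  SameFamily : Sub → Sub → Set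
  SameFamily U W = (U ≐ W) ⊎ ExactlyPoint U W

  InG : Mat3 → ℕ → Plane → Set
  InG C i W = InQuadric C i ⟪ W ⟫ × SameFamily ⟪ W ⟫ π₁ ×
              ¬ (⟪ W ⟫ ≐ π₁) × Disjoint ⟪ W ⟫ π₂

  SamePlane : Plane → Plane → Set
  SamePlane U W = ⟪ U ⟫ ≐ ⟪ W ⟫

  PlanesMeetInAtMostPoint : Plane → Plane → Set
  PlanesMeetInAtMostPoint U W = AtMostPoint ⟪ U ⟫ ⟪ W ⟫

-- Write points of PG(5,q) as (X, Y) with X, Y ∈ GF(q)³. A plane of 𝒢_i is disjoint from π₂,
-- hence the graph {(y B, y)} of a matrix B; it lies on 𝒬_i exactly when y B C^i yᵀ vanishes
-- identically, i.e. when B C^i is the matrix S_t of y ↦ y × t, and it differs from π₁ exactly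
-- when t ≠ 0. So 𝒢_i consists of the q³ - 1 planes W(i, t) : X C^i = Y × t with t ≠ 0.
-- If W(i, t) ≠ W(i′, t′) shared a line, its Y-parts would span a plane of vectors c with
-- c × t = (c × t′) C^k, k = i′ - i. For k = 0 this forces t = t′; otherwise a case analysis
-- with cross products yields x ≠ 0 with x C^k = μ x, so C^(dk) fixes x for some 0 < d < q.
-- But 0 < dk < q³ - 1, and no such power of a Singer cycle fixes a nonzero vector, since the
-- powers of C act transitively on the q³ - 1 nonzero vectors.

module Submission where

open import Defs
open import Level using (0ℓ)
open import Algebra.Bundles using (CommutativeRing)
open import Algebra.Solver.Ring.AlmostCommutativeRing
  using (AlmostCommutativeRing; fromCommutativeRing; _-Raw-AlmostCommutative⟶_; Induced-equivalence)
open import Data.Empty using (⊥; ⊥-elim)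
open import Data.Fin using (Fin; zero; suc; toℕ; _↑ˡ_; _↑ʳ_)
import Data.Fin as Fin
import Data.Fin.Properties as Fin
open import Data.Integer using (ℤ; -[1+_]; sign; ∣_∣; _◃_)
import Data.Integer as ℤ
import Data.Integer.Properties as ℤ
open import Data.List using (List; []; _∷_; length; filter; cartesianProduct; map; lookup; upTo)
import Data.List.Properties as List
open import Data.List.Membership.Propositional using (_∈_)
import Data.List.Membership.Propositional.Properties as ∈
import Data.List.Membership.Setoid.Properties as ∈ₛ
open import Data.List.Relation.Unary.All using (All; []; _∷_)
import Data.List.Relation.Unary.All as All
import Data.List.Relation.Unary.All.Properties as All
import Data.List.Relation.Unary.Any as Any
open import Data.List.Relation.Unary.Any using (here; there)
open import Data.List.Relation.Unary.AllPairs using (AllPairs; []; _∷_)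
import Data.List.Relation.Unary.AllPairs.Properties as AllPairs
open import Data.List.Relation.Unary.Unique.Propositional using (Unique)
import Data.List.Relation.Unary.Unique.Propositional.Properties as Unique
open import Data.Maybe using (just; nothing)
open import Data.Nat using (ℕ; zero; suc; _<_; _≤_; _∸_; s≤s; z≤n)
import Data.Nat as ℕ
import Data.Nat.Properties as ℕ
open import Data.Nat.DivMod using (_%_; _/_; m≡m%n+[m/n]*n; m%n<n)
open import Data.Nat.Solver using (module +-*-Solver)
open import Data.Product using (Σ; _×_; _,_; proj₁; proj₂; ∃₂)
open import Data.Product.Properties using (≡-dec)
open import Data.Sign using (Sign)
import Data.Sign as Sign
open import Data.Sum using (inj₂)
open import Function using (_∘′_)
open import Relation.Binary.Definitions using (DecidableEquality; WeaklyDecidable; tri<; tri≈; tri>)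
open import Relation.Binary.PropositionalEquality
open import Relation.Nullary using (¬_; Dec; yes; no; ¬?)

module FieldArithmetic (F : FiniteField) where
  open FiniteField F

  commutativeRing : CommutativeRing 0ℓ 0ℓ
  commutativeRing = record { isCommutativeRing = isCommutativeRing }

  open CommutativeRing commutativeRing public
    using (+-identityˡ; +-identityʳ; *-identityˡ; *-identityʳ; zeroˡ; zeroʳ; +-comm; *-comm; +-assoc; *-assoc; -‿inverseʳ)
  open CommutativeRing commutativeRing using (ring; semiring; *-commutativeSemigroup)
  open import Algebra.Properties.Ring ring public
    using (-‿involutive; -‿distribʳ-*; -0#≈0#; -‿+-comm; -1*x≈-x; +-inverseʳ-unique; x∙y⁻¹≈ε⇒x≈y)
  open import Algebra.Properties.Semiring.Mult.TCOptimised semiring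
    using (×-homo-+; ×1-homo-*; 1+×) renaming (_×_ to _×ₙ_)
  open import Algebra.Properties.CommutativeSemigroup *-commutativeSemigroup using (interchange)
  open import Algebra.Properties.Semiring.Exp semiring public using (_^_; ^-homo-*)
  open ≡-Reasoning

  signed : Sign → Carrier
  signed Sign.+ = 1#
  signed Sign.- = - 1#

  -- The coefficient map of the ring solver.
  fromℤ : ℤ → Carrier
  fromℤ (ℤ.+ n)    = n ×ₙ 1#
  fromℤ -[1+ n ] = - (suc n ×ₙ 1#)

  fromℤ-◃ : ∀ s n → fromℤ (s ◃ n) ≡ signed s * (n ×ₙ 1#)
  fromℤ-◃ s      zero    = sym (zeroʳ (signed s))
  fromℤ-◃ Sign.+ (suc n) = sym (*-identityˡ _)
  fromℤ-◃ Sign.- (suc n) = sym (-1*x≈-x _)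

  fromℤ-signAbs : ∀ i → fromℤ i ≡ signed (sign i) * (∣ i ∣ ×ₙ 1#)
  fromℤ-signAbs (ℤ.+ n)    = trans (cong fromℤ (sym (ℤ.+◃n≡+n n))) (fromℤ-◃ Sign.+ n)
  fromℤ-signAbs -[1+ n ] = fromℤ-◃ Sign.- (suc n)

  signed-* : ∀ s t → signed (s Sign.* t) ≡ signed s * signed t
  signed-* Sign.+ t      = sym (*-identityˡ _)
  signed-* Sign.- Sign.+ = sym (*-identityʳ _)
  signed-* Sign.- Sign.- = begin
    1#              ≡⟨ sym (-‿involutive 1#) ⟩
    - - 1#          ≡⟨ cong -_ (sym (-1*x≈-x 1#)) ⟩
    - (- 1# * 1#)   ≡⟨ -‿distribʳ-* (- 1#) 1# ⟩
    - 1# * - 1#     ∎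

  fromℤ-* : ∀ i j → fromℤ (i ℤ.* j) ≡ fromℤ i * fromℤ j
  fromℤ-* i j = begin
    fromℤ (sign i Sign.* sign j ◃ ∣ i ∣ ℕ.* ∣ j ∣)
      ≡⟨ fromℤ-◃ (sign i Sign.* sign j) (∣ i ∣ ℕ.* ∣ j ∣) ⟩
    signed (sign i Sign.* sign j) * ((∣ i ∣ ℕ.* ∣ j ∣) ×ₙ 1#)
      ≡⟨ cong₂ _*_ (signed-* (sign i) (sign j)) (×1-homo-* ∣ i ∣ ∣ j ∣) ⟩
    (signed (sign i) * signed (sign j)) * ((∣ i ∣ ×ₙ 1#) * (∣ j ∣ ×ₙ 1#))
      ≡⟨ interchange _ _ _ _ ⟩
    (signed (sign i) * (∣ i ∣ ×ₙ 1#)) * (signed (sign j) * (∣ j ∣ ×ₙ 1#))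
      ≡⟨ sym (cong₂ _*_ (fromℤ-signAbs i) (fromℤ-signAbs j)) ⟩
    fromℤ i * fromℤ j ∎

  a+x-[a+y]≡x-y : ∀ a x y → (a + x) + - (a + y) ≡ x + - y
  a+x-[a+y]≡x-y a x y = begin
    (a + x) + - (a + y)    ≡⟨ cong ((a + x) +_) (sym (-‿+-comm a y)) ⟩
    (a + x) + (- a + - y)  ≡⟨ cong (_+ (- a + - y)) (+-comm a x) ⟩
    (x + a) + (- a + - y)  ≡⟨ +-assoc x a _ ⟩
    x + (a + (- a + - y))  ≡⟨ cong (x +_) (sym (+-assoc a (- a) (- y))) ⟩
    x + ((a + - a) + - y)  ≡⟨ cong (λ z → x + (z + - y)) (-‿inverseʳ a) ⟩
    x + (0# + - y)         ≡⟨ cong (x +_) (+-identityˡ (- y)) ⟩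
    x + - y                ∎

  fromℤ-⊖ : ∀ m n → fromℤ (m ℤ.⊖ n) ≡ m ×ₙ 1# + - (n ×ₙ 1#)
  fromℤ-⊖ m       zero    = sym (trans (cong (m ×ₙ 1# +_) -0#≈0#) (+-identityʳ _))
  fromℤ-⊖ zero    (suc n) = sym (+-identityˡ _)
  fromℤ-⊖ (suc m) (suc n) = begin
    fromℤ (suc m ℤ.⊖ suc n)               ≡⟨ cong fromℤ (ℤ.[1+m]⊖[1+n]≡m⊖n m n) ⟩
    fromℤ (m ℤ.⊖ n)                       ≡⟨ fromℤ-⊖ m n ⟩
    m ×ₙ 1# + - (n ×ₙ 1#)                 ≡⟨ sym (a+x-[a+y]≡x-y 1# _ _) ⟩
    1# + m ×ₙ 1# + - (1# + n ×ₙ 1#)       ≡⟨ sym (cong₂ (λ a b → a + - b) (1+× m 1#) (1+× n 1#)) ⟩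
    suc m ×ₙ 1# + - (suc n ×ₙ 1#)         ∎

  fromℤ-+ : ∀ i j → fromℤ (i ℤ.+ j) ≡ fromℤ i + fromℤ j
  fromℤ-+ (ℤ.+ m)    (ℤ.+ n)    = ×-homo-+ 1# m n
  fromℤ-+ (ℤ.+ m)    -[1+ n ] = fromℤ-⊖ m (suc n)
  fromℤ-+ -[1+ m ] (ℤ.+ n)    = trans (fromℤ-⊖ n (suc m)) (+-comm _ _)
  fromℤ-+ -[1+ m ] -[1+ n ] = begin
    - (suc (suc (m ℕ.+ n)) ×ₙ 1#)          ≡⟨ cong (λ k → - (suc k ×ₙ 1#)) (sym (ℕ.+-suc m n)) ⟩
    - ((suc m ℕ.+ suc n) ×ₙ 1#)            ≡⟨ cong -_ (×-homo-+ 1# (suc m) (suc n)) ⟩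
    - (suc m ×ₙ 1# + suc n ×ₙ 1#)           ≡⟨ sym (-‿+-comm _ _) ⟩
    - (suc m ×ₙ 1#) + - (suc n ×ₙ 1#)       ∎

  fromℤ-neg : ∀ i → fromℤ (ℤ.- i) ≡ - fromℤ i
  fromℤ-neg (ℤ.+ zero)    = sym -0#≈0#
  fromℤ-neg (ℤ.+ suc n)   = refl
  fromℤ-neg -[1+ n ]    = sym (-‿involutive _)

  almostCommutativeRing : AlmostCommutativeRing 0ℓ 0ℓ
  almostCommutativeRing = fromCommutativeRing commutativeRing

  fromℤ-morphism : ℤ.+-*-rawRing -Raw-AlmostCommutative⟶ almostCommutativeRing
  fromℤ-morphism = record
    { ⟦_⟧ = fromℤ ; +-homo = fromℤ-+ ; *-homo = fromℤ-* ; -‿homo = fromℤ-neg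
    ; 0-homo = refl ; 1-homo = refl }

  fromℤ-cong? : WeaklyDecidable (Induced-equivalence fromℤ-morphism)
  fromℤ-cong? i j with i ℤ.≟ j
  ... | yes refl = just refl
  ... | no _     = nothing

  open import Algebra.Solver.Ring ℤ.+-*-rawRing almostCommutativeRing fromℤ-morphism fromℤ-cong? public
    using (Polynomial; solve; _:=_; con; _:+_; _:*_; :-_)

  _⁻¹[_] : (x : Carrier) → x ≢ 0# → Carrier
  x ⁻¹[ x≢0 ] = proj₁ (inverse x x≢0)

  x*x⁻¹≡1 : ∀ x (x≢0 : x ≢ 0#) → x * x ⁻¹[ x≢0 ] ≡ 1#
  x*x⁻¹≡1 x x≢0 = proj₂ (inverse x x≢0)

  1≢0 : 1# ≢ 0#
  1≢0 1≡0 = 0≢1 (sym 1≡0)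

  -x≡0⇒x≡0 : ∀ {x} → - x ≡ 0# → x ≡ 0#
  -x≡0⇒x≡0 {x} -x≡0 = trans (sym (-‿involutive x)) (trans (cong -_ -x≡0) -0#≈0#)

  x≡0⇒-x≡0 : ∀ {x} → x ≡ 0# → - x ≡ 0#
  x≡0⇒-x≡0 refl = -0#≈0#

  x*y≡a⇒y≡x⁻¹*a : ∀ {x y a} (x≢0 : x ≢ 0#) → x * y ≡ a → y ≡ x ⁻¹[ x≢0 ] * a
  x*y≡a⇒y≡x⁻¹*a {x} {y} {a} x≢0 xy≡a = begin
    y              ≡⟨ sym (*-identityˡ y) ⟩
    1# * y         ≡⟨ cong (_* y) (sym (x*x⁻¹≡1 x x≢0)) ⟩
    (x * i) * y    ≡⟨ solve 3 (λ x i y → (x :* i) :* y := i :* (x :* y)) refl x i y ⟩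
    i * (x * y)    ≡⟨ cong (i *_) xy≡a ⟩
    i * a          ∎
    where i = x ⁻¹[ x≢0 ]

  *-cancelˡ-≢0 : ∀ {x y z} → x ≢ 0# → x * y ≡ x * z → y ≡ z
  *-cancelˡ-≢0 x≢0 xy≡xz = trans (x*y≡a⇒y≡x⁻¹*a x≢0 xy≡xz) (sym (x*y≡a⇒y≡x⁻¹*a x≢0 refl))

  x*y≡0⇒y≡0 : ∀ {x y} → x ≢ 0# → x * y ≡ 0# → y ≡ 0#
  x*y≡0⇒y≡0 {x} {y} x≢0 xy≡0 = *-cancelˡ-≢0 x≢0 (trans xy≡0 (sym (zeroʳ x)))

  *-≢0 : ∀ {x y} → x ≢ 0# → y ≢ 0# → x * y ≢ 0#
  *-≢0 x≢0 y≢0 xy≡0 = y≢0 (x*y≡0⇒y≡0 x≢0 xy≡0)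

  x-y≡0⇒x≡y : ∀ {x y} → x + - y ≡ 0# → x ≡ y
  x-y≡0⇒x≡y = x∙y⁻¹≈ε⇒x≈y _ _

  ^-≢0 : ∀ {x} → x ≢ 0# → ∀ n → x ^ n ≢ 0#
  ^-≢0 x≢0 zero    = 1≢0
  ^-≢0 x≢0 (suc n) = *-≢0 x≢0 (^-≢0 x≢0 n)

  x^m≡x^n⇒x^[n∸m]≡1 : ∀ {x} → x ≢ 0# → ∀ {m n} → m ≤ n → x ^ m ≡ x ^ n → x ^ (n ∸ m) ≡ 1#
  x^m≡x^n⇒x^[n∸m]≡1 {x} x≢0 {m} {n} m≤n xᵐ≡xⁿ = *-cancelˡ-≢0 (^-≢0 x≢0 m) (begin
    x ^ m * x ^ (n ∸ m)   ≡⟨ sym (^-homo-* x m (n ∸ m)) ⟩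
    x ^ (m ℕ.+ (n ∸ m))   ≡⟨ cong (x ^_) (ℕ.m+[n∸m]≡n m≤n) ⟩
    x ^ n                 ≡⟨ sym xᵐ≡xⁿ ⟩
    x ^ m                 ≡⟨ sym (*-identityʳ _) ⟩
    x ^ m * 1#            ∎)

pattern f0 = zero
pattern f1 = suc zero
pattern f2 = suc (suc zero)

vec : ∀ {a} {A : Set a} → A → A → A → Fin 3 → A
vec a b c f0 = a
vec a b c f1 = b
vec a b c f2 = c

vec-η : ∀ {a} {A : Set a} (x : Fin 3 → A) j → vec (x f0) (x f1) (x f2) j ≡ x j
vec-η x f0 = refl
vec-η x f1 = refl
vec-η x f2 = refl

mat : ∀ {a} {A : Set a} → A → A → A → A → A → A → A → A → A → Fin 3 → Fin 3 → A
mat a b c d e f g h i f0 = vec a b c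
mat a b c d e f g h i f1 = vec d e f
mat a b c d e f g h i f2 = vec g h i

-- Stated over an arbitrary signature so that the same formulas serve for
-- field elements and for ring-solver polynomials.
module Coordinates {A : Set} (add mul : A → A → A) (neg : A → A) (𝟘 𝟙 : A) where
  infixl 6 _⊕_ _⊖_
  infixl 7 _⊗_
  infix 8 ⊖_

  _⊕_ _⊗_ _⊖_ : A → A → A
  _⊕_ = add
  _⊗_ = mul
  x ⊖ y = x ⊕ neg y

  ⊖_ : A → A
  ⊖_ = neg

  unit : Fin 3 → Fin 3 → A
  unit f0 = vec 𝟙 𝟘 𝟘
  unit f1 = vec 𝟘 𝟙 𝟘
  unit f2 = vec 𝟘 𝟘 𝟙

  Σ₃ : (Fin 3 → A) → A
  Σ₃ f = f f0 ⊕ (f f1 ⊕ (f f2 ⊕ 𝟘))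

  _⋆_ : (Fin 3 → A) → (Fin 3 → Fin 3 → A) → Fin 3 → A
  (x ⋆ M) k = Σ₃ (λ j → x j ⊗ M j k)

  dot : (Fin 3 → A) → (Fin 3 → A) → A
  dot x y = Σ₃ (λ j → x j ⊗ y j)

  cross : (Fin 3 → A) → (Fin 3 → A) → Fin 3 → A
  cross x y = vec (x f1 ⊗ y f2 ⊖ x f2 ⊗ y f1) (x f2 ⊗ y f0 ⊖ x f0 ⊗ y f2) (x f0 ⊗ y f1 ⊖ x f1 ⊗ y f0)

  skew : (Fin 3 → A) → Fin 3 → Fin 3 → A
  skew t = mat 𝟘 (⊖ t f2) (t f1) (t f2) 𝟘 (⊖ t f0) (⊖ t f1) (t f0) 𝟘

  det : (Fin 3 → Fin 3 → A) → A
  det M = dot (M f0) (cross (M f1) (M f2))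

  -- Columns are the cross products of pairs of rows, so that M · adj M = det M · I.
  adj : (Fin 3 → Fin 3 → A) → Fin 3 → Fin 3 → A
  adj M j f0 = cross (M f1) (M f2) j
  adj M j f1 = cross (M f2) (M f0) j
  adj M j f2 = cross (M f0) (M f1) j

module Vectors (F : FiniteField) where
  open FieldArithmetic F
  open LinAlg F hiding (_^_)
  open ≡-Reasoning
  open Coordinates _+_ _*_ -_ 0# 1# public using (unit; cross; dot; skew; det; adj)
  module ℙ {n : ℕ} = Coordinates {Polynomial n} _:+_ _:*_ :-_ (con (ℤ.+ 0)) (con (ℤ.+ 1))

  infix 4 _≋_
  _≋_ : ∀ {n} → Vec n → Vec n → Set
  u ≋ v = ∀ j → u j ≡ v j

  infixr 7 _·_
  _·_ : ∀ {n} → Carrier → Vec n → Vec n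
  (a · x) j = a * x j

  lincomb : ∀ {n} → Carrier → Vec n → Carrier → Vec n → Vec n
  lincomb a x b y j = a * x j + b * y j

  Dependent : ∀ {n} → Vec n → Vec n → Set
  Dependent u v = Σ Carrier λ a → Σ Carrier λ b → ¬ (a ≡ 0# × b ≡ 0#) × lincomb a u b v ≋ zeroV

  ₀ ₁ : ∀ {n} → Polynomial n
  ₀ = con (ℤ.+ 0)
  ₁ = con (ℤ.+ 1)

  ·M-congˡ : ∀ {x y : Vec 3} (A : Mat3) → x ≋ y → x ·M A ≋ y ·M A
  ·M-congˡ A x≋y k rewrite x≋y f0 | x≋y f1 | x≋y f2 = refl

  ·M-congʳ : ∀ (x : Vec 3) {A B : Mat3} → MatEq A B → x ·M A ≋ x ·M B
  ·M-congʳ x A≡B k rewrite A≡B f0 k | A≡B f1 k | A≡B f2 k = refl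

  ·M-assoc : ∀ (x : Vec 3) (A B : Mat3) → (x ·M A) ·M B ≋ x ·M (A ⊗ B)
  ·M-assoc x A B k = solve 15 (λ x0 x1 x2 a b c d e f g h i y0 y1 y2 →
      let X = vec x0 x1 x2 ; M = mat a b c d e f g h i ; Y = vec y0 y1 y2 in
      ℙ.dot (X ℙ.⋆ M) Y := ℙ.dot X (λ j → ℙ.dot (M j) Y))
    refl (x f0) (x f1) (x f2) (A f0 f0) (A f0 f1) (A f0 f2) (A f1 f0) (A f1 f1) (A f1 f2)
         (A f2 f0) (A f2 f1) (A f2 f2) (B f0 k) (B f1 k) (B f2 k)

  unit-·M : ∀ j (A : Mat3) → unit j ·M A ≋ A j
  unit-·M f0 A k = solve 3 (λ a b c → ℙ.dot (ℙ.unit f0) (vec a b c) := a) refl (A f0 k) (A f1 k) (A f2 k)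
  unit-·M f1 A k = solve 3 (λ a b c → ℙ.dot (ℙ.unit f1) (vec a b c) := b) refl (A f0 k) (A f1 k) (A f2 k)
  unit-·M f2 A k = solve 3 (λ a b c → ℙ.dot (ℙ.unit f2) (vec a b c) := c) refl (A f0 k) (A f1 k) (A f2 k)

  ·M-identityʳ : ∀ (x : Vec 3) → x ·M I3 ≋ x
  ·M-identityʳ x f0 = solve 3 (λ a b c → ℙ.dot (vec a b c) (ℙ.unit f0) := a) refl (x f0) (x f1) (x f2)
  ·M-identityʳ x f1 = solve 3 (λ a b c → ℙ.dot (vec a b c) (ℙ.unit f1) := b) refl (x f0) (x f1) (x f2)
  ·M-identityʳ x f2 = solve 3 (λ a b c → ℙ.dot (vec a b c) (ℙ.unit f2) := c) refl (x f0) (x f1) (x f2)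

  ·M-lincomb : ∀ a (x : Vec 3) b (y : Vec 3) (A : Mat3) → lincomb a x b y ·M A ≋ lincomb a (x ·M A) b (y ·M A)
  ·M-lincomb a x b y A k = solve 11 (λ a b x0 x1 x2 y0 y1 y2 m0 m1 m2 →
      ℙ.dot (λ j → a :* vec x0 x1 x2 j :+ b :* vec y0 y1 y2 j) (vec m0 m1 m2)
      := a :* ℙ.dot (vec x0 x1 x2) (vec m0 m1 m2) :+ b :* ℙ.dot (vec y0 y1 y2) (vec m0 m1 m2))
    refl a b (x f0) (x f1) (x f2) (y f0) (y f1) (y f2) (A f0 k) (A f1 k) (A f2 k)

  ·M-scale : ∀ a (x : Vec 3) (A : Mat3) → (a · x) ·M A ≋ a · (x ·M A)
  ·M-scale a x A k = solve 7 (λ a x0 x1 x2 m0 m1 m2 →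
      ℙ.dot (λ j → a :* vec x0 x1 x2 j) (vec m0 m1 m2) := a :* ℙ.dot (vec x0 x1 x2) (vec m0 m1 m2))
    refl a (x f0) (x f1) (x f2) (A f0 k) (A f1 k) (A f2 k)

  ·M-zeroˡ : ∀ {x : Vec 3} (A : Mat3) → x ≋ zeroV → x ·M A ≋ zeroV
  ·M-zeroˡ A x≋0 k = trans (·M-congˡ A x≋0 k)
    (solve 3 (λ m0 m1 m2 → ℙ.dot (λ _ → ₀) (vec m0 m1 m2) := ₀) refl (A f0 k) (A f1 k) (A f2 k))

  ·M-skew : ∀ (c t : Vec 3) → c ·M skew t ≋ cross c t
  ·M-skew c t f0 = solve 6 (λ c0 c1 c2 t0 t1 t2 → (vec c0 c1 c2 ℙ.⋆ ℙ.skew (vec t0 t1 t2)) f0 := ℙ.cross (vec c0 c1 c2) (vec t0 t1 t2) f0) refl (c f0) (c f1) (c f2) (t f0) (t f1) (t f2)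
  ·M-skew c t f1 = solve 6 (λ c0 c1 c2 t0 t1 t2 → (vec c0 c1 c2 ℙ.⋆ ℙ.skew (vec t0 t1 t2)) f1 := ℙ.cross (vec c0 c1 c2) (vec t0 t1 t2) f1) refl (c f0) (c f1) (c f2) (t f0) (t f1) (t f2)
  ·M-skew c t f2 = solve 6 (λ c0 c1 c2 t0 t1 t2 → (vec c0 c1 c2 ℙ.⋆ ℙ.skew (vec t0 t1 t2)) f2 := ℙ.cross (vec c0 c1 c2) (vec t0 t1 t2) f2) refl (c f0) (c f1) (c f2) (t f0) (t f1) (t f2)

  cross-cong : ∀ {a b c d : Vec 3} → a ≋ b → c ≋ d → cross a c ≋ cross b d
  cross-cong a≋b c≋d j rewrite a≋b f0 | a≋b f1 | a≋b f2 | c≋d f0 | c≋d f1 | c≋d f2 = refl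

  dot-cong : ∀ {a b c d : Vec 3} → a ≋ b → c ≋ d → dot a c ≡ dot b d
  dot-cong a≋b c≋d rewrite a≋b f0 | a≋b f1 | a≋b f2 | c≋d f0 | c≋d f1 | c≋d f2 = refl

  cross-self : ∀ (x : Vec 3) → cross x x ≋ zeroV
  cross-self x f0 = solve 2 (λ a b → a :* b :+ :- (b :* a) := ₀) refl (x f1) (x f2)
  cross-self x f1 = solve 2 (λ a b → a :* b :+ :- (b :* a) := ₀) refl (x f2) (x f0)
  cross-self x f2 = solve 2 (λ a b → a :* b :+ :- (b :* a) := ₀) refl (x f0) (x f1)

  cross≋0-sym : ∀ (x y : Vec 3) → cross x y ≋ zeroV → cross y x ≋ zeroV
  cross≋0-sym x y x×y≋0 j = trans (lemma j) (x≡0⇒-x≡0 (x×y≋0 j))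
    where
    antisym : ∀ a b c d → c * b + - (d * a) ≡ - (a * d + - (b * c))
    antisym = solve 4 (λ a b c d → c :* b :+ :- (d :* a) := :- (a :* d :+ :- (b :* c))) refl
    lemma : ∀ j → cross y x j ≡ - cross x y j
    lemma f0 = antisym (x f1) (x f2) (y f1) (y f2)
    lemma f1 = antisym (x f2) (x f0) (y f2) (y f0)
    lemma f2 = antisym (x f0) (x f1) (y f0) (y f1)

  cross-zeroʳ : ∀ (y : Vec 3) {z : Vec 3} → z ≋ zeroV → cross y z ≋ zeroV
  cross-zeroʳ y {z} z≋0 j = trans (cross-cong {y} {y} {z} (λ _ → refl) z≋0 j) (lemma j)
    where
    lemma : ∀ j → cross y zeroV j ≡ 0#
    lemma f0 = solve 2 (λ a b → a :* ₀ :+ :- (b :* ₀) := ₀) refl (y f1) (y f2)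
    lemma f1 = solve 2 (λ a b → a :* ₀ :+ :- (b :* ₀) := ₀) refl (y f2) (y f0)
    lemma f2 = solve 2 (λ a b → a :* ₀ :+ :- (b :* ₀) := ₀) refl (y f0) (y f1)

  cross-parallel : ∀ l m (t : Vec 3) → cross (l · t) (m · t) ≋ zeroV
  cross-parallel l m t j = lemma j
    where
    twist : ∀ l m a b → (l * a) * (m * b) + - ((l * b) * (m * a)) ≡ 0#
    twist = solve 4 (λ l m a b → (l :* a) :* (m :* b) :+ :- ((l :* b) :* (m :* a)) := ₀) refl
    lemma : ∀ j → cross (l · t) (m · t) j ≡ 0#
    lemma f0 = twist l m (t f1) (t f2)
    lemma f1 = twist l m (t f2) (t f0)
    lemma f2 = twist l m (t f0) (t f1)

  cross-lincombˡ : ∀ a (u : Vec 3) b (v t : Vec 3) → cross (lincomb a u b v) t ≋ lincomb a (cross u t) b (cross v t)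
  cross-lincombˡ a u b v t j = lemma j a b (u f0) (u f1) (u f2) (v f0) (v f1) (v f2) (t f0) (t f1) (t f2)
    where
    lemma : ∀ j a b u0 u1 u2 v0 v1 v2 t0 t1 t2 → let U = vec u0 u1 u2 ; V = vec v0 v1 v2 ; T = vec t0 t1 t2 in
            cross (lincomb a U b V) T j ≡ lincomb a (cross U T) b (cross V T) j
    lemma f0 = solve 11 (λ a b u0 u1 u2 v0 v1 v2 t0 t1 t2 → let U = vec u0 u1 u2 ; V = vec v0 v1 v2 ; T = vec t0 t1 t2 in
      ℙ.cross (λ l → a :* U l :+ b :* V l) T f0 := a :* ℙ.cross U T f0 :+ b :* ℙ.cross V T f0) refl
    lemma f1 = solve 11 (λ a b u0 u1 u2 v0 v1 v2 t0 t1 t2 → let U = vec u0 u1 u2 ; V = vec v0 v1 v2 ; T = vec t0 t1 t2 in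
      ℙ.cross (λ l → a :* U l :+ b :* V l) T f1 := a :* ℙ.cross U T f1 :+ b :* ℙ.cross V T f1) refl
    lemma f2 = solve 11 (λ a b u0 u1 u2 v0 v1 v2 t0 t1 t2 → let U = vec u0 u1 u2 ; V = vec v0 v1 v2 ; T = vec t0 t1 t2 in
      ℙ.cross (λ l → a :* U l :+ b :* V l) T f2 := a :* ℙ.cross U T f2 :+ b :* ℙ.cross V T f2) refl

  cross-lincombʳ : ∀ (c : Vec 3) a (t : Vec 3) b (s : Vec 3) → cross c (lincomb a t b s) ≋ lincomb a (cross c t) b (cross c s)
  cross-lincombʳ c a t b s j = lemma j a b (c f0) (c f1) (c f2) (t f0) (t f1) (t f2) (s f0) (s f1) (s f2)
    where
    lemma : ∀ j a b c0 c1 c2 t0 t1 t2 s0 s1 s2 → let C = vec c0 c1 c2 ; T = vec t0 t1 t2 ; S = vec s0 s1 s2 in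
            cross C (lincomb a T b S) j ≡ lincomb a (cross C T) b (cross C S) j
    lemma f0 = solve 11 (λ a b c0 c1 c2 t0 t1 t2 s0 s1 s2 → let C = vec c0 c1 c2 ; T = vec t0 t1 t2 ; S = vec s0 s1 s2 in
      ℙ.cross C (λ l → a :* T l :+ b :* S l) f0 := a :* ℙ.cross C T f0 :+ b :* ℙ.cross C S f0) refl
    lemma f1 = solve 11 (λ a b c0 c1 c2 t0 t1 t2 s0 s1 s2 → let C = vec c0 c1 c2 ; T = vec t0 t1 t2 ; S = vec s0 s1 s2 in
      ℙ.cross C (λ l → a :* T l :+ b :* S l) f1 := a :* ℙ.cross C T f1 :+ b :* ℙ.cross C S f1) refl
    lemma f2 = solve 11 (λ a b c0 c1 c2 t0 t1 t2 s0 s1 s2 → let C = vec c0 c1 c2 ; T = vec t0 t1 t2 ; S = vec s0 s1 s2 in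
      ℙ.cross C (λ l → a :* T l :+ b :* S l) f2 := a :* ℙ.cross C T f2 :+ b :* ℙ.cross C S f2) refl

  cross-scaleˡ : ∀ a (u t : Vec 3) → cross (a · u) t ≋ a · cross u t
  cross-scaleˡ a u t j = lemma j a (u f0) (u f1) (u f2) (t f0) (t f1) (t f2)
    where
    lemma : ∀ j a u0 u1 u2 t0 t1 t2 → cross (a · vec u0 u1 u2) (vec t0 t1 t2) j ≡ a * cross (vec u0 u1 u2) (vec t0 t1 t2) j
    lemma f0 = solve 7 (λ a u0 u1 u2 t0 t1 t2 → ℙ.cross (λ l → a :* vec u0 u1 u2 l) (vec t0 t1 t2) f0 := a :* ℙ.cross (vec u0 u1 u2) (vec t0 t1 t2) f0) refl
    lemma f1 = solve 7 (λ a u0 u1 u2 t0 t1 t2 → ℙ.cross (λ l → a :* vec u0 u1 u2 l) (vec t0 t1 t2) f1 := a :* ℙ.cross (vec u0 u1 u2) (vec t0 t1 t2) f1) refl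
    lemma f2 = solve 7 (λ a u0 u1 u2 t0 t1 t2 → ℙ.cross (λ l → a :* vec u0 u1 u2 l) (vec t0 t1 t2) f2 := a :* ℙ.cross (vec u0 u1 u2) (vec t0 t1 t2) f2) refl

  cross-scaleʳ : ∀ a (u t : Vec 3) → cross u (a · t) ≋ a · cross u t
  cross-scaleʳ a u t j = lemma j a (u f0) (u f1) (u f2) (t f0) (t f1) (t f2)
    where
    lemma : ∀ j a u0 u1 u2 t0 t1 t2 → cross (vec u0 u1 u2) (a · vec t0 t1 t2) j ≡ a * cross (vec u0 u1 u2) (vec t0 t1 t2) j
    lemma f0 = solve 7 (λ a u0 u1 u2 t0 t1 t2 → ℙ.cross (vec u0 u1 u2) (λ l → a :* vec t0 t1 t2 l) f0 := a :* ℙ.cross (vec u0 u1 u2) (vec t0 t1 t2) f0) refl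
    lemma f1 = solve 7 (λ a u0 u1 u2 t0 t1 t2 → ℙ.cross (vec u0 u1 u2) (λ l → a :* vec t0 t1 t2 l) f1 := a :* ℙ.cross (vec u0 u1 u2) (vec t0 t1 t2) f1) refl
    lemma f2 = solve 7 (λ a u0 u1 u2 t0 t1 t2 → ℙ.cross (vec u0 u1 u2) (λ l → a :* vec t0 t1 t2 l) f2 := a :* ℙ.cross (vec u0 u1 u2) (vec t0 t1 t2) f2) refl

  dot-scaleˡ : ∀ a (x y : Vec 3) → dot (a · x) y ≡ a * dot x y
  dot-scaleˡ a x y = solve 7 (λ a x0 x1 x2 y0 y1 y2 →
      ℙ.dot (λ l → a :* vec x0 x1 x2 l) (vec y0 y1 y2) := a :* ℙ.dot (vec x0 x1 x2) (vec y0 y1 y2))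
    refl a (x f0) (x f1) (x f2) (y f0) (y f1) (y f2)

  dot-comm : ∀ (x y : Vec 3) → dot x y ≡ dot y x
  dot-comm x y = solve 6 (λ x0 x1 x2 y0 y1 y2 → ℙ.dot (vec x0 x1 x2) (vec y0 y1 y2) := ℙ.dot (vec y0 y1 y2) (vec x0 x1 x2))
    refl (x f0) (x f1) (x f2) (y f0) (y f1) (y f2)

  dot-crossˡ : ∀ (x y : Vec 3) → dot (cross x y) x ≡ 0#
  dot-crossˡ x y = solve 6 (λ x0 x1 x2 y0 y1 y2 → ℙ.dot (ℙ.cross (vec x0 x1 x2) (vec y0 y1 y2)) (vec x0 x1 x2) := ₀)
    refl (x f0) (x f1) (x f2) (y f0) (y f1) (y f2)

  dot-crossʳ : ∀ (x y : Vec 3) → dot (cross x y) y ≡ 0#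
  dot-crossʳ x y = solve 6 (λ x0 x1 x2 y0 y1 y2 → ℙ.dot (ℙ.cross (vec x0 x1 x2) (vec y0 y1 y2)) (vec y0 y1 y2) := ₀)
    refl (x f0) (x f1) (x f2) (y f0) (y f1) (y f2)

  cross-cross : ∀ (c t s : Vec 3) → cross (cross c t) (cross c s) ≋ dot c (cross t s) · c
  cross-cross c t s j = trans (lemma j (c f0) (c f1) (c f2) (t f0) (t f1) (t f2) (s f0) (s f1) (s f2))
                               (cong (dot c (cross t s) *_) (vec-η c j))
    where
    lemma : ∀ j c0 c1 c2 t0 t1 t2 s0 s1 s2 → let C = vec c0 c1 c2 ; T = vec t0 t1 t2 ; S = vec s0 s1 s2 in
            cross (cross C T) (cross C S) j ≡ (dot C (cross T S) · C) j
    lemma f0 = solve 9 (λ c0 c1 c2 t0 t1 t2 s0 s1 s2 → let C = vec c0 c1 c2 ; T = vec t0 t1 t2 ; S = vec s0 s1 s2 in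
      ℙ.cross (ℙ.cross C T) (ℙ.cross C S) f0 := ℙ.dot C (ℙ.cross T S) :* C f0) refl
    lemma f1 = solve 9 (λ c0 c1 c2 t0 t1 t2 s0 s1 s2 → let C = vec c0 c1 c2 ; T = vec t0 t1 t2 ; S = vec s0 s1 s2 in
      ℙ.cross (ℙ.cross C T) (ℙ.cross C S) f1 := ℙ.dot C (ℙ.cross T S) :* C f1) refl
    lemma f2 = solve 9 (λ c0 c1 c2 t0 t1 t2 s0 s1 s2 → let C = vec c0 c1 c2 ; T = vec t0 t1 t2 ; S = vec s0 s1 s2 in
      ℙ.cross (ℙ.cross C T) (ℙ.cross C S) f2 := ℙ.dot C (ℙ.cross T S) :* C f2) refl

  cramer : ∀ (u v w : Vec 3) j l →
           cross u v j * w l ≡ cross w v j * u l + cross u w j * v l + dot w (cross u v) * unit j l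
  cramer u v w j l = go j l
    where
    identity : ∀ {n} → Fin 3 → Fin 3 → (_ _ _ _ _ _ _ _ _ : Polynomial n) → Polynomial n × Polynomial n
    identity j l u0 u1 u2 v0 v1 v2 w0 w1 w2 = let U = vec u0 u1 u2 ; V = vec v0 v1 v2 ; W = vec w0 w1 w2 in
      ℙ.cross U V j :* W l := ℙ.cross W V j :* U l :+ ℙ.cross U W j :* V l :+ ℙ.dot W (ℙ.cross U V) :* ℙ.unit j l
    go : ∀ j l → cross u v j * w l ≡ cross w v j * u l + cross u w j * v l + dot w (cross u v) * unit j l
    go f0 f0 = solve 9 (identity f0 f0) refl (u f0) (u f1) (u f2) (v f0) (v f1) (v f2) (w f0) (w f1) (w f2)
    go f0 f1 = solve 9 (identity f0 f1) refl (u f0) (u f1) (u f2) (v f0) (v f1) (v f2) (w f0) (w f1) (w f2)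
    go f0 f2 = solve 9 (identity f0 f2) refl (u f0) (u f1) (u f2) (v f0) (v f1) (v f2) (w f0) (w f1) (w f2)
    go f1 f0 = solve 9 (identity f1 f0) refl (u f0) (u f1) (u f2) (v f0) (v f1) (v f2) (w f0) (w f1) (w f2)
    go f1 f1 = solve 9 (identity f1 f1) refl (u f0) (u f1) (u f2) (v f0) (v f1) (v f2) (w f0) (w f1) (w f2)
    go f1 f2 = solve 9 (identity f1 f2) refl (u f0) (u f1) (u f2) (v f0) (v f1) (v f2) (w f0) (w f1) (w f2)
    go f2 f0 = solve 9 (identity f2 f0) refl (u f0) (u f1) (u f2) (v f0) (v f1) (v f2) (w f0) (w f1) (w f2)
    go f2 f1 = solve 9 (identity f2 f1) refl (u f0) (u f1) (u f2) (v f0) (v f1) (v f2) (w f0) (w f1) (w f2)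
    go f2 f2 = solve 9 (identity f2 f2) refl (u f0) (u f1) (u f2) (v f0) (v f1) (v f2) (w f0) (w f1) (w f2)

  isZero? : (t : Vec 3) → Dec (IsZero t)
  isZero? t with t f0 ≟ 0# | t f1 ≟ 0# | t f2 ≟ 0#
  ... | yes t0 | yes t1 | yes t2 = yes λ { f0 → t0 ; f1 → t1 ; f2 → t2 }
  ... | no t0≢0 | _ | _ = no λ t≋0 → t0≢0 (t≋0 f0)
  ... | yes _ | no t1≢0 | _ = no λ t≋0 → t1≢0 (t≋0 f1)
  ... | yes _ | yes _ | no t2≢0 = no λ t≋0 → t2≢0 (t≋0 f2)

  nonZeroCoordinate : (t : Vec 3) → NonZero t → Σ (Fin 3) (λ j → t j ≢ 0#)
  nonZeroCoordinate t t≢0 with t f0 ≟ 0# | t f1 ≟ 0# | t f2 ≟ 0#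
  ... | no t0≢0 | _ | _ = f0 , t0≢0
  ... | yes _ | no t1≢0 | _ = f1 , t1≢0
  ... | yes _ | yes _ | no t2≢0 = f2 , t2≢0
  ... | yes t0 | yes t1 | yes t2 = ⊥-elim (t≢0 λ { f0 → t0 ; f1 → t1 ; f2 → t2 })

  cross≋0⇒minors≡ : ∀ {x t : Vec 3} → cross x t ≋ zeroV → ∀ a b → x a * t b ≡ x b * t a
  cross≋0⇒minors≡ x×t≋0 f0 f0 = refl
  cross≋0⇒minors≡ x×t≋0 f1 f1 = refl
  cross≋0⇒minors≡ x×t≋0 f2 f2 = refl
  cross≋0⇒minors≡ x×t≋0 f1 f2 = x-y≡0⇒x≡y (x×t≋0 f0)
  cross≋0⇒minors≡ x×t≋0 f2 f0 = x-y≡0⇒x≡y (x×t≋0 f1)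
  cross≋0⇒minors≡ x×t≋0 f0 f1 = x-y≡0⇒x≡y (x×t≋0 f2)
  cross≋0⇒minors≡ x×t≋0 f2 f1 = sym (x-y≡0⇒x≡y (x×t≋0 f0))
  cross≋0⇒minors≡ x×t≋0 f0 f2 = sym (x-y≡0⇒x≡y (x×t≋0 f1))
  cross≋0⇒minors≡ x×t≋0 f1 f0 = sym (x-y≡0⇒x≡y (x×t≋0 f2))

  cross≋0⇒parallel : ∀ (x t : Vec 3) → NonZero t → cross x t ≋ zeroV → Σ Carrier (λ l → x ≋ l · t)
  cross≋0⇒parallel x t t≢0 x×t≋0 with nonZeroCoordinate t t≢0
  ... | j , tj≢0 = x j * i , λ l → begin
      x l              ≡⟨ x*y≡a⇒y≡x⁻¹*a tj≢0 refl ⟩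
      i * (t j * x l)  ≡⟨ cong (i *_) (trans (*-comm (t j) (x l)) (sym (cross≋0⇒minors≡ x×t≋0 j l))) ⟩
      i * (x j * t l)  ≡⟨ solve 3 (λ i a b → i :* (a :* b) := (a :* i) :* b) refl i (x j) (t l) ⟩
      (x j * i) * t l  ∎
    where i = t j ⁻¹[ tj≢0 ]

  cross≋0⇒dependent : ∀ (u v : Vec 3) → cross u v ≋ zeroV → Dependent u v
  cross≋0⇒dependent u v u×v≋0 with isZero? u
  ... | yes u≋0 = 1# , 0# , (λ (1≡0 , _) → 1≢0 1≡0) , λ l →
      trans (cong₂ (λ a b → 1# * a + 0# * b) (u≋0 l) refl) (solve 1 (λ b → ₁ :* ₀ :+ ₀ :* b := ₀) refl (v l))
  ... | no u≢0 with nonZeroCoordinate u u≢0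
  ... | j , uj≢0 = v j , - u j , (λ (_ , -uj≡0) → uj≢0 (-x≡0⇒x≡0 -uj≡0)) , λ l → begin
      v j * u l + - u j * v l     ≡⟨ solve 4 (λ a b c d → b :* c :+ :- a :* d := c :* b :+ :- (a :* d)) refl (u j) (v j) (u l) (v l) ⟩
      u l * v j + - (u j * v l)   ≡⟨ cong (λ z → z + - (u j * v l)) (sym (cross≋0⇒minors≡ u×v≋0 j l)) ⟩
      u j * v l + - (u j * v l)   ≡⟨ -‿inverseʳ _ ⟩
      0#                          ∎

  parallel-trans : ∀ (a b : Vec 3) {t : Vec 3} → NonZero t → cross a t ≋ zeroV → cross b t ≋ zeroV → cross a b ≋ zeroV
  parallel-trans a b {t} t≢0 a×t≋0 b×t≋0 k
    with cross≋0⇒parallel a t t≢0 a×t≋0 | cross≋0⇒parallel b t t≢0 b×t≋0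
  ... | l , a≋lt | m , b≋mt = trans (cross-cong a≋lt b≋mt k) (cross-parallel l m t k)

module Matrices (F : FiniteField) where
  open FieldArithmetic F
  open LinAlg F hiding (_^_)
  open Vectors F
  open ≡-Reasoning

  Invertible : Mat3 → Set
  Invertible Y = Σ Mat3 λ Y⁻¹ → (∀ y → (y ·M Y) ·M Y⁻¹ ≋ y) × (∀ y → (y ·M Y⁻¹) ·M Y ≋ y)

  ·M-adj : ∀ (y : Vec 3) (Y : Mat3) → (y ·M Y) ·M adj Y ≋ det Y · y
  ·M-adj y Y k = trans (go k) (cong (det Y *_) (vec-η y k))
    where
    identity : ∀ {n} → Fin 3 → (_ _ _ _ _ _ _ _ _ _ _ _ : Polynomial n) → Polynomial n × Polynomial n
    identity k y0 y1 y2 a b c d e f g h i = let M = mat a b c d e f g h i ; Y = vec y0 y1 y2 in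
      ((Y ℙ.⋆ M) ℙ.⋆ ℙ.adj M) k := ℙ.det M :* Y k
    go : ∀ k → ((y ·M Y) ·M adj Y) k ≡ det Y * vec (y f0) (y f1) (y f2) k
    go f0 = solve 12 (identity f0) refl (y f0) (y f1) (y f2) (Y f0 f0) (Y f0 f1) (Y f0 f2) (Y f1 f0) (Y f1 f1) (Y f1 f2) (Y f2 f0) (Y f2 f1) (Y f2 f2)
    go f1 = solve 12 (identity f1) refl (y f0) (y f1) (y f2) (Y f0 f0) (Y f0 f1) (Y f0 f2) (Y f1 f0) (Y f1 f1) (Y f1 f2) (Y f2 f0) (Y f2 f1) (Y f2 f2)
    go f2 = solve 12 (identity f2) refl (y f0) (y f1) (y f2) (Y f0 f0) (Y f0 f1) (Y f0 f2) (Y f1 f0) (Y f1 f1) (Y f1 f2) (Y f2 f0) (Y f2 f1) (Y f2 f2)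

  adj-·M : ∀ (y : Vec 3) (Y : Mat3) → (y ·M adj Y) ·M Y ≋ det Y · y
  adj-·M y Y k = trans (go k) (cong (det Y *_) (vec-η y k))
    where
    identity : ∀ {n} → Fin 3 → (_ _ _ _ _ _ _ _ _ _ _ _ : Polynomial n) → Polynomial n × Polynomial n
    identity k y0 y1 y2 a b c d e f g h i = let M = mat a b c d e f g h i ; Y = vec y0 y1 y2 in
      ((Y ℙ.⋆ ℙ.adj M) ℙ.⋆ M) k := ℙ.det M :* Y k
    go : ∀ k → ((y ·M adj Y) ·M Y) k ≡ det Y * vec (y f0) (y f1) (y f2) k
    go f0 = solve 12 (identity f0) refl (y f0) (y f1) (y f2) (Y f0 f0) (Y f0 f1) (Y f0 f2) (Y f1 f0) (Y f1 f1) (Y f1 f2) (Y f2 f0) (Y f2 f1) (Y f2 f2)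
    go f1 = solve 12 (identity f1) refl (y f0) (y f1) (y f2) (Y f0 f0) (Y f0 f1) (Y f0 f2) (Y f1 f0) (Y f1 f1) (Y f1 f2) (Y f2 f0) (Y f2 f1) (Y f2 f2)
    go f2 = solve 12 (identity f2) refl (y f0) (y f1) (y f2) (Y f0 f0) (Y f0 f1) (Y f0 f2) (Y f1 f0) (Y f1 f1) (Y f1 f2) (Y f2 f0) (Y f2 f1) (Y f2 f2)

  ·M-scaleʳ : ∀ a (x : Vec 3) (M : Mat3) → x ·M (λ j k → a * M j k) ≋ a · (x ·M M)
  ·M-scaleʳ a x M k = solve 7 (λ a x0 x1 x2 m0 m1 m2 →
      ℙ.dot (vec x0 x1 x2) (λ j → a :* vec m0 m1 m2 j) := a :* ℙ.dot (vec x0 x1 x2) (vec m0 m1 m2))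
    refl a (x f0) (x f1) (x f2) (M f0 k) (M f1 k) (M f2 k)

  ·M-firstRows : ∀ a b (Y : Mat3) → vec a b 0# ·M Y ≋ lincomb a (Y f0) b (Y f1)
  ·M-firstRows a b Y k = solve 5 (λ a b r0 r1 r2 → ℙ.dot (vec a b ₀) (vec r0 r1 r2) := a :* r0 :+ b :* r1)
    refl a b (Y f0 k) (Y f1 k) (Y f2 k)

  -- If det Y = 0, the rows of adj Y lie in the left kernel, so the first two rows of Y are parallel.
  trivialKernel⇒invertible : ∀ (Y : Mat3) → (∀ c → c ·M Y ≋ zeroV → c ≋ zeroV) → Invertible Y
  trivialKernel⇒invertible Y kernel with det Y ≟ 0#
  ... | no d≢0 = (λ j k → d⁻¹ * adj Y j k)
               , (λ y k → trans (·M-scaleʳ d⁻¹ (y ·M Y) (adj Y) k) (cancel (·M-adj y Y) k))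
               , λ y k → begin
      ((y ·M (λ j k → d⁻¹ * adj Y j k)) ·M Y) k ≡⟨ ·M-congˡ Y (·M-scaleʳ d⁻¹ y (adj Y)) k ⟩
      ((d⁻¹ · (y ·M adj Y)) ·M Y) k           ≡⟨ ·M-scale d⁻¹ (y ·M adj Y) Y k ⟩
      d⁻¹ * ((y ·M adj Y) ·M Y) k             ≡⟨ cancel (adj-·M y Y) k ⟩
      y k                                      ∎
    where
    d⁻¹ = det Y ⁻¹[ d≢0 ]
    cancel : ∀ {w y : Vec 3} → w ≋ det Y · y → d⁻¹ · w ≋ y
    cancel w≋dy k = trans (cong (d⁻¹ *_) (w≋dy k)) (sym (x*y≡a⇒y≡x⁻¹*a d≢0 refl))
  ... | yes d≡0 = ⊥-elim (¬a≡b≡0 (first-rows≋0 f0 , first-rows≋0 f1))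
    where
    adjRow≋0 : ∀ j → adj Y j ≋ zeroV
    adjRow≋0 j k = trans (sym (unit-·M j (adj Y) k)) (kernel (unit j ·M adj Y) (λ l →
      trans (adj-·M (unit j) Y l) (trans (cong (_* unit j l) d≡0) (zeroˡ _))) k)
    dependentRows = cross≋0⇒dependent (Y f0) (Y f1) (λ j → adjRow≋0 j f2)
    a = proj₁ dependentRows
    b = proj₁ (proj₂ dependentRows)
    ¬a≡b≡0 = proj₁ (proj₂ (proj₂ dependentRows))
    first-rows≋0 : vec a b 0# ≋ zeroV
    first-rows≋0 = kernel (vec a b 0#) λ k → trans (·M-firstRows a b Y k) (proj₂ (proj₂ (proj₂ dependentRows)) k)

  axial : Mat3 → Vec 3
  axial G = vec (G f2 f1) (G f0 f2) (G f1 f0)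

  dot-unitʳ : ∀ (x : Vec 3) b → dot x (unit b) ≡ x b
  dot-unitʳ x f0 = solve 3 (λ a b c → ℙ.dot (vec a b c) (ℙ.unit f0) := a) refl (x f0) (x f1) (x f2)
  dot-unitʳ x f1 = solve 3 (λ a b c → ℙ.dot (vec a b c) (ℙ.unit f1) := b) refl (x f0) (x f1) (x f2)
  dot-unitʳ x f2 = solve 3 (λ a b c → ℙ.dot (vec a b c) (ℙ.unit f2) := c) refl (x f0) (x f1) (x f2)

  form-units : ∀ (G : Mat3) a b → dot (unit a ·M G) (unit b) ≡ G a b
  form-units G a b = trans (dot-cong {unit a ·M G} {G a} {unit b} (unit-·M a G) (λ _ → refl)) (dot-unitʳ (G a) b)

  form-polarization : ∀ (G : Mat3) (x y : Vec 3) →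
    dot (lincomb 1# x 1# y ·M G) (lincomb 1# x 1# y) ≡ dot (x ·M G) x + dot (y ·M G) y + (dot (x ·M G) y + dot (y ·M G) x)
  form-polarization G x y = solve 15 (λ x0 x1 x2 y0 y1 y2 a b c d e f g h i →
      let X = vec x0 x1 x2 ; Y = vec y0 y1 y2 ; M = mat a b c d e f g h i ; S = λ j → ₁ :* X j :+ ₁ :* Y j in
      ℙ.dot (S ℙ.⋆ M) S := ℙ.dot (X ℙ.⋆ M) X :+ ℙ.dot (Y ℙ.⋆ M) Y :+ (ℙ.dot (X ℙ.⋆ M) Y :+ ℙ.dot (Y ℙ.⋆ M) X))
    refl (x f0) (x f1) (x f2) (y f0) (y f1) (y f2)
         (G f0 f0) (G f0 f1) (G f0 f2) (G f1 f0) (G f1 f1) (G f1 f2) (G f2 f0) (G f2 f1) (G f2 f2)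

  alternating⇒skew : ∀ (G : Mat3) → (∀ y → dot (y ·M G) y ≡ 0#) → MatEq G (skew (axial G))
  alternating⇒skew G alternating = go
    where
    diagonal : ∀ j → G j j ≡ 0#
    diagonal j = trans (sym (form-units G j j)) (alternating (unit j))
    antisymmetric : ∀ a b → G a b ≡ - G b a
    antisymmetric a b = +-inverseʳ-unique (G b a) (G a b) (begin
      G b a + G a b          ≡⟨ +-comm _ _ ⟩
      G a b + G b a          ≡⟨ sym (cong₂ _+_ (form-units G a b) (form-units G b a)) ⟩
      qab                    ≡⟨ sym (+-identityˡ qab) ⟩
      0# + qab               ≡⟨ cong (λ z → z + qab) (sym (trans (cong₂ _+_ (alternating (unit a)) (alternating (unit b))) (+-identityʳ 0#))) ⟩
      qa + qb + qab          ≡⟨ sym (form-polarization G (unit a) (unit b)) ⟩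
      form (lincomb 1# (unit a) 1# (unit b)) ≡⟨ alternating (lincomb 1# (unit a) 1# (unit b)) ⟩
      0#                     ∎)
      where
      form : Vec 3 → Carrier
      form z = dot (z ·M G) z
      qa = form (unit a)
      qb = form (unit b)
      qab = dot (unit a ·M G) (unit b) + dot (unit b ·M G) (unit a)
    go : MatEq G (skew (axial G))
    go f0 f0 = diagonal f0
    go f1 f1 = diagonal f1
    go f2 f2 = diagonal f2
    go f0 f2 = refl
    go f1 f0 = refl
    go f2 f1 = refl
    go f0 f1 = antisymmetric f0 f1
    go f1 f2 = antisymmetric f1 f2
    go f2 f0 = antisymmetric f2 f0

n³-1≡[n-1]*[n²+n+1] : ∀ n → 1 ≤ n → n ℕ.^ 3 ∸ 1 ≡ (n ∸ 1) ℕ.* (n ℕ.^ 2 ℕ.+ n ℕ.+ 1)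
n³-1≡[n-1]*[n²+n+1] (suc p) _ = cong (_∸ 1) (solve 1 (λ p →
    (con 1 :+ p) :^ 3 := con 1 :+ p :* ((con 1 :+ p) :^ 2 :+ (con 1 :+ p) :+ con 1)) refl p)
  where open +-*-Solver

module Counting where

  length-cartesianProduct : ∀ {A B : Set} (xs : List A) (ys : List B) →
                            length (cartesianProduct xs ys) ≡ length xs ℕ.* length ys
  length-cartesianProduct []       ys = refl
  length-cartesianProduct (x ∷ xs) ys = trans (List.length-++ (map (x ,_) ys))
    (cong₂ ℕ._+_ (List.length-map (x ,_) ys) (length-cartesianProduct xs ys))

  module _ {A : Set} (_≟A_ : DecidableEquality A) where

    without : A → List A → List A
    without z = filter (λ y → ¬? (y ≟A z))

    length-without : ∀ z (xs : List A) → Unique xs → z ∈ xs → suc (length (without z xs)) ≡ length xs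
    length-without z (x ∷ xs) (x∉xs ∷ unique) z∈x∷xs with x ≟A z
    ... | yes refl = cong (suc ∘′ length) (List.filter-all (λ y → ¬? (y ≟A z)) (All.map (λ x≢y y≡x → x≢y (sym y≡x)) x∉xs))
    ... | no x≢z with z∈x∷xs
    ...   | here z≡x    = ⊥-elim (x≢z (sym z≡x))
    ...   | there z∈xs  = cong suc (length-without z xs unique z∈xs)

  Unique⇒lookup-injective : ∀ {A : Set} {xs : List A} → Unique xs →
                            ∀ (i j : Fin (length xs)) → i Fin.< j → lookup xs i ≢ lookup xs j
  Unique⇒lookup-injective (x∉xs ∷ _)     zero    (suc j) _         = All.lookup x∉xs (∈.∈-lookup j)
  Unique⇒lookup-injective (_ ∷ unique)   (suc i) (suc j) (s≤s i<j) = Unique⇒lookup-injective unique i j i<j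

  AllPairs-≢⇒ : ∀ {A : Set} {V : A → Set} {R : A → A → Set} {xs : List A} →
                (∀ {a b} → V a → V b → a ≢ b → R a b) → AllPairs _≢_ xs → All V xs → AllPairs R xs
  AllPairs-≢⇒ r []           []         = []
  AllPairs-≢⇒ r (x≢xs ∷ ≢xs) (vx ∷ vxs) = All.zipWith (λ (x≢y , vy) → r vx vy x≢y) (x≢xs , vxs) ∷ AllPairs-≢⇒ r ≢xs vxs

  pigeonhole-∈ : ∀ {A : Set} {n} (xs : List A) → length xs < n → (f : Fin n → A) → (∀ i → f i ∈ xs) →
                 ∃₂ λ i j → i Fin.< j × f i ≡ f j
  pigeonhole-∈ xs len<n f f∈xs with Fin.pigeonhole len<n (λ i → Any.index (f∈xs i))
  ... | i , j , i<j , same-index = i , j , i<j , ∈ₛ.index-injective (setoid _) (f∈xs i) (f∈xs j) same-index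

module Enumeration (F : FiniteField) where
  open FieldArithmetic F
  open LinAlg F hiding (_^_)
  open Vectors F
  open Counting

  Triple : Set
  Triple = Carrier × Carrier × Carrier

  _≟₃_ : DecidableEquality Triple
  _≟₃_ = ≡-dec _≟_ (≡-dec _≟_ _≟_)

  0₃ : Triple
  0₃ = 0# , 0# , 0#

  toVec : Triple → Vec 3
  toVec (a , b , c) = vec a b c

  toVec-injective : ∀ t t′ → toVec t ≋ toVec t′ → t ≡ t′
  toVec-injective (a , b , c) (a′ , b′ , c′) t≋t′ = cong₂ _,_ (t≋t′ f0) (cong₂ _,_ (t≋t′ f1) (t≋t′ f2))

  toVec-nonZero : ∀ t → t ≢ 0₃ → NonZero (toVec t)
  toVec-nonZero t t≢0 t≋0 = t≢0 (toVec-injective t 0₃ λ { f0 → t≋0 f0 ; f1 → t≋0 f1 ; f2 → t≋0 f2 })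

  triples : List Triple
  triples = cartesianProduct elements (cartesianProduct elements elements)

  ∈-triples : ∀ t → t ∈ triples
  ∈-triples (a , b , c) = ∈.∈-cartesianProduct⁺ (complete a) (∈.∈-cartesianProduct⁺ (complete b) (complete c))

  length-triples : length triples ≡ q ℕ.^ 3
  length-triples = trans (length-cartesianProduct elements _)
    (cong (q ℕ.*_) (trans (length-cartesianProduct elements elements) (cong (q ℕ.*_) (sym (ℕ.*-identityʳ q)))))

  nonzeroTriples : List Triple
  nonzeroTriples = without _≟₃_ 0₃ triples

  unique-nonzeroTriples : Unique nonzeroTriples
  unique-nonzeroTriples = Unique.filter⁺ _ (Unique.cartesianProduct⁺ unique (Unique.cartesianProduct⁺ unique unique))

  length-nonzeroTriples : length nonzeroTriples ≡ q ℕ.^ 3 ∸ 1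
  length-nonzeroTriples = cong (_∸ 1) (trans (length-without _≟₃_ 0₃ triples
    (Unique.cartesianProduct⁺ unique (Unique.cartesianProduct⁺ unique unique)) (∈-triples 0₃)) length-triples)

  ∈-nonzeroTriples⁺ : ∀ t → t ≢ 0₃ → t ∈ nonzeroTriples
  ∈-nonzeroTriples⁺ t = ∈.∈-filter⁺ (λ y → ¬? (y ≟₃ 0₃)) (∈-triples t)

  ∈-nonzeroTriples⁻ : ∀ {t} → t ∈ nonzeroTriples → t ≢ 0₃
  ∈-nonzeroTriples⁻ t∈ = proj₂ (∈.∈-filter⁻ (λ y → ¬? (y ≟₃ 0₃)) {xs = triples} t∈)

  nonzeroScalars : List Carrier
  nonzeroScalars = without _≟_ 0# elements

  length-nonzeroScalars : length nonzeroScalars ≡ q ∸ 1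
  length-nonzeroScalars = cong (_∸ 1) (length-without _≟_ 0# elements unique (complete 0#))

  ∈-nonzeroScalars : ∀ x → x ≢ 0# → x ∈ nonzeroScalars
  ∈-nonzeroScalars x = ∈.∈-filter⁺ (λ y → ¬? (y ≟ 0#)) (complete x)

  2≤q : 2 ≤ q
  2≤q = distinct elements (complete 0#) (complete 1#)
    where
    distinct : ∀ (xs : List Carrier) → 0# ∈ xs → 1# ∈ xs → 2 ≤ length xs
    distinct (x ∷ [])     (here 0≡x) (here 1≡x) = ⊥-elim (0≢1 (trans 0≡x (sym 1≡x)))
    distinct (x ∷ y ∷ xs) _          _          = s≤s (s≤s z≤n)

module MatrixPowers (F : FiniteField) where
  open FieldArithmetic F
  open LinAlg F renaming (_^_ to _^ₘ_)
  open Vectors F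
  open ≡-Reasoning

  ·M-^-+ : ∀ (A : Mat3) (x : Vec 3) a b → x ·M (A ^ₘ (a ℕ.+ b)) ≋ (x ·M (A ^ₘ a)) ·M (A ^ₘ b)
  ·M-^-+ A x zero    b k = ·M-congˡ (A ^ₘ b) (λ j → sym (·M-identityʳ x j)) k
  ·M-^-+ A x (suc a) b k = begin
    (x ·M (A ⊗ (A ^ₘ (a ℕ.+ b)))) k          ≡⟨ sym (·M-assoc x A (A ^ₘ (a ℕ.+ b)) k) ⟩
    ((x ·M A) ·M (A ^ₘ (a ℕ.+ b))) k         ≡⟨ ·M-^-+ A (x ·M A) a b k ⟩
    (((x ·M A) ·M (A ^ₘ a)) ·M (A ^ₘ b)) k   ≡⟨ ·M-congˡ (A ^ₘ b) (·M-assoc x A (A ^ₘ a)) k ⟩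
    ((x ·M (A ⊗ (A ^ₘ a))) ·M (A ^ₘ b)) k    ∎

  eigenvector-^-* : ∀ (A : Mat3) (x : Vec 3) k μ → x ·M (A ^ₘ k) ≋ μ · x → ∀ d → x ·M (A ^ₘ (d ℕ.* k)) ≋ (μ ^ d) · x
  eigenvector-^-* A x k μ xAᵏ≋μx zero    j = trans (·M-identityʳ x j) (sym (*-identityˡ (x j)))
  eigenvector-^-* A x k μ xAᵏ≋μx (suc d) j = begin
    (x ·M (A ^ₘ (k ℕ.+ d ℕ.* k))) j            ≡⟨ ·M-^-+ A x k (d ℕ.* k) j ⟩
    ((x ·M (A ^ₘ k)) ·M (A ^ₘ (d ℕ.* k))) j    ≡⟨ ·M-congˡ (A ^ₘ (d ℕ.* k)) xAᵏ≋μx j ⟩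
    ((μ · x) ·M (A ^ₘ (d ℕ.* k))) j            ≡⟨ ·M-scale μ x (A ^ₘ (d ℕ.* k)) j ⟩
    μ * (x ·M (A ^ₘ (d ℕ.* k))) j              ≡⟨ cong (μ *_) (eigenvector-^-* A x k μ xAᵏ≋μx d j) ⟩
    μ * ((μ ^ d) * x j)                        ≡⟨ sym (*-assoc μ _ _) ⟩
    (μ ^ suc d) * x j                          ∎

  fixed-^-* : ∀ (A : Mat3) (x : Vec 3) m → x ·M (A ^ₘ m) ≋ x → ∀ j → x ·M (A ^ₘ (j ℕ.* m)) ≋ x
  fixed-^-* A x m fixed zero    k = ·M-identityʳ x k
  fixed-^-* A x m fixed (suc j) k = begin
    (x ·M (A ^ₘ (m ℕ.+ j ℕ.* m))) k           ≡⟨ ·M-^-+ A x m (j ℕ.* m) k ⟩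
    ((x ·M (A ^ₘ m)) ·M (A ^ₘ (j ℕ.* m))) k   ≡⟨ ·M-congˡ (A ^ₘ (j ℕ.* m)) fixed k ⟩
    (x ·M (A ^ₘ (j ℕ.* m))) k                 ≡⟨ fixed-^-* A x m fixed j k ⟩
    x k                                       ∎

  fixed-^-% : ∀ (A : Mat3) (x : Vec 3) m .{{_ : ℕ.NonZero m}} → x ·M (A ^ₘ m) ≋ x →
              ∀ K → x ·M (A ^ₘ K) ≋ x ·M (A ^ₘ (K % m))
  fixed-^-% A x m fixed K k = begin
    (x ·M (A ^ₘ K)) k                                       ≡⟨ cong (λ e → (x ·M (A ^ₘ e)) k) K≡ ⟩
    (x ·M (A ^ₘ ((K / m) ℕ.* m ℕ.+ K % m))) k               ≡⟨ ·M-^-+ A x ((K / m) ℕ.* m) (K % m) k ⟩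
    ((x ·M (A ^ₘ ((K / m) ℕ.* m))) ·M (A ^ₘ (K % m))) k     ≡⟨ ·M-congˡ (A ^ₘ (K % m)) (fixed-^-* A x m fixed (K / m)) k ⟩
    (x ·M (A ^ₘ (K % m))) k                                 ∎
    where
    K≡ : K ≡ (K / m) ℕ.* m ℕ.+ K % m
    K≡ = trans (m≡m%n+[m/n]*n K m) (ℕ.+-comm (K % m) _)

module SingerCycleProperties (F : FiniteField) (C : LinAlg.Mat3 F) (singer : LinAlg.SingerCycle F C) where
  open FieldArithmetic F
  open LinAlg F renaming (_^_ to _^ₘ_)
  open SingerCycle singer
  open Vectors F
  open Enumeration F
  open MatrixPowers F
  open Counting
  open ≡-Reasoning

  q³-1 q²+q+1 : ℕ
  q³-1 = q ℕ.^ 3 ∸ 1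
  q²+q+1 = q ℕ.^ 2 ℕ.+ q ℕ.+ 1

  q³-1≡[q-1]*[q²+q+1] : q³-1 ≡ (q ∸ 1) ℕ.* q²+q+1
  q³-1≡[q-1]*[q²+q+1] = n³-1≡[n-1]*[n²+n+1] q (ℕ.≤-trans (s≤s z≤n) 2≤q)

  q²+q+1≤q³-1 : q²+q+1 ≤ q³-1
  q²+q+1≤q³-1 = subst (q²+q+1 ≤_) (sym q³-1≡[q-1]*[q²+q+1]) (ℕ.m≤n*m q²+q+1 (q ∸ 1) {{ℕ.>-nonZero (ℕ.∸-monoˡ-≤ 1 2≤q)}})

  <q²+q+1⇒≤q³-1 : ∀ {i} → i < q²+q+1 → i ≤ q³-1
  <q²+q+1⇒≤q³-1 i<N = ℕ.≤-trans (ℕ.<⇒≤ i<N) q²+q+1≤q³-1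

  ·M-C^[q³-1] : ∀ (x : Vec 3) → x ·M (C ^ₘ q³-1) ≋ x
  ·M-C^[q³-1] x k = trans (·M-congʳ x order-divides k) (·M-identityʳ x k)

  ·M-C^-trivialKernel : ∀ (x : Vec 3) k → k ≤ q³-1 → x ·M (C ^ₘ k) ≋ zeroV → x ≋ zeroV
  ·M-C^-trivialKernel x k k≤ xCᵏ≋0 j = begin
    x j                                              ≡⟨ sym (·M-C^[q³-1] x j) ⟩
    (x ·M (C ^ₘ q³-1)) j                             ≡⟨ cong (λ e → (x ·M (C ^ₘ e)) j) (sym (ℕ.m+[n∸m]≡n k≤)) ⟩
    (x ·M (C ^ₘ (k ℕ.+ (q³-1 ∸ k)))) j               ≡⟨ ·M-^-+ C x k (q³-1 ∸ k) j ⟩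
    ((x ·M (C ^ₘ k)) ·M (C ^ₘ (q³-1 ∸ k))) j         ≡⟨ ·M-zeroˡ (C ^ₘ (q³-1 ∸ k)) xCᵏ≋0 j ⟩
    0#                                               ∎

  -- C^m would fix the whole orbit of x, i.e. every nonzero vector, so the
  -- q³ - 1 nonzero vectors would be among the m vectors x C^r, r < m.
  no-fixed-vectors : ∀ (x : Vec 3) m → NonZero x → 0 < m → m < q³-1 → ¬ (x ·M (C ^ₘ m) ≋ x)
  no-fixed-vectors x m@(suc _) x≢0 _ m<q³-1 fixed = collision (pigeonhole-∈ (upTo m) m<n residue residue∈upTo)
    where
    n = length nonzeroTriples
    m<n : length (upTo m) < n
    m<n = subst₂ _<_ (sym (List.length-upTo m)) (sym length-nonzeroTriples) m<q³-1
    reach : ∀ t → t ≢ 0₃ → Σ ℕ λ r → r < m × x ·M (C ^ₘ r) ≋ toVec t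
    reach t t≢0 with transitive x (toVec t) x≢0 (toVec-nonZero t t≢0)
    ... | K , xCᴷ≋t = K % m , m%n<n K m , λ j → trans (sym (fixed-^-% C x m fixed K j)) (xCᴷ≋t j)
    reachᵢ : (p : Fin n) → Σ ℕ λ r → r < m × x ·M (C ^ₘ r) ≋ toVec (lookup nonzeroTriples p)
    reachᵢ p = reach (lookup nonzeroTriples p) (∈-nonzeroTriples⁻ (∈.∈-lookup p))
    residue : Fin n → ℕ
    residue p = proj₁ (reachᵢ p)
    residue∈upTo : ∀ p → residue p ∈ upTo m
    residue∈upTo p = ∈.∈-upTo⁺ (proj₁ (proj₂ (reachᵢ p)))
    collision : ∃₂ (λ i j → i Fin.< j × residue i ≡ residue j) → ⊥
    collision (i , j , i<j , same) = Unique⇒lookup-injective unique-nonzeroTriples i j i<j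
      (toVec-injective _ _ λ k → trans (sym (proj₂ (proj₂ (reachᵢ i)) k))
        (trans (cong (λ r → (x ·M (C ^ₘ r)) k) same) (proj₂ (proj₂ (reachᵢ j)) k)))

  -- An eigenvalue μ lies in GF(q)*, so μ^d = 1 for some 0 < d < q, and then C^(dk) fixes x with 0 < dk < q³ - 1.
  no-eigenvectors : ∀ (x : Vec 3) k μ → NonZero x → 0 < k → k < q²+q+1 → ¬ (x ·M (C ^ₘ k) ≋ μ · x)
  no-eigenvectors x k μ x≢0 0<k k<N eigen with μ ≟ 0#
  ... | yes μ≡0 = x≢0 (·M-C^-trivialKernel x k (<q²+q+1⇒≤q³-1 k<N)
                    λ j → trans (eigen j) (trans (cong (_* x j) μ≡0) (zeroˡ (x j))))
  ... | no μ≢0 = collision (pigeonhole-∈ nonzeroScalars len<q power power∈)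
    where
    power : Fin q → Carrier
    power j = μ ^ toℕ j
    power∈ : ∀ j → power j ∈ nonzeroScalars
    power∈ j = ∈-nonzeroScalars _ (^-≢0 μ≢0 (toℕ j))
    len<q : length nonzeroScalars < q
    len<q = subst (_< q) (sym length-nonzeroScalars) (ℕ.∸-monoʳ-< {o = 0} (s≤s z≤n) (ℕ.≤-trans (s≤s z≤n) 2≤q))
    collision : ∃₂ (λ i j → i Fin.< j × power i ≡ power j) → ⊥
    collision (i , j , i<j , same) = no-fixed-vectors x (d ℕ.* k) x≢0 (ℕ.*-mono-≤ 1≤d 0<k) dk<q³-1 λ l →
      trans (eigenvector-^-* C x k μ eigen d l) (trans (cong (_* x l) μᵈ≡1) (*-identityˡ (x l)))
      where
      d = toℕ j ∸ toℕ i
      μᵈ≡1 : μ ^ d ≡ 1#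
      μᵈ≡1 = x^m≡x^n⇒x^[n∸m]≡1 μ≢0 (ℕ.<⇒≤ i<j) same
      1≤d : 1 ≤ d
      1≤d = ℕ.m<n⇒0<n∸m i<j
      d≤q-1 : d ≤ q ∸ 1
      d≤q-1 = ℕ.≤-trans (ℕ.m∸n≤m (toℕ j) (toℕ i)) (ℕ.∸-monoˡ-≤ 1 (Fin.toℕ<n j))
      dk<q³-1 : d ℕ.* k < q³-1
      dk<q³-1 = ℕ.<-≤-trans (ℕ.*-monoʳ-< d {{ℕ.>-nonZero 1≤d}} k<N)
        (subst (d ℕ.* q²+q+1 ≤_) (sym q³-1≡[q-1]*[q²+q+1]) (ℕ.*-monoˡ-≤ q²+q+1 d≤q-1))

module GraphPlanes (F : FiniteField) where
  open FieldArithmetic F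
  open LinAlg F hiding (_^_)
  open Vectors F
  open ≡-Reasoning

  join : Vec 3 → Vec 3 → Vec 6
  join x y zero                = x f0
  join x y (suc zero)          = x f1
  join x y (suc (suc zero))    = x f2
  join x y (suc (suc (suc k))) = y k

  Xpart-join : ∀ x y → Xpart (join x y) ≋ x
  Xpart-join x y f0 = refl
  Xpart-join x y f1 = refl
  Xpart-join x y f2 = refl

  byHalves : ∀ {P : Fin 6 → Set} → (∀ (k : Fin 3) → P (k ↑ˡ 3)) → (∀ k → P (3 ↑ʳ k)) → ∀ m → P m
  byHalves onX onY zero                = onX f0
  byHalves onX onY (suc zero)          = onX f1
  byHalves onX onY (suc (suc zero))    = onX f2
  byHalves onX onY (suc (suc (suc k))) = onY k

  graph : Mat3 → Plane
  graph B = record { basis = λ j → join (B j) (I3 j)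
                   ; independent = λ c c≋0 j → trans (sym (·M-identityʳ c j)) (c≋0 (3 ↑ʳ j)) }

  Xpart-comb : ∀ B c k → Xpart (comb c (Plane.basis (graph B))) k ≡ (c ·M B) k
  Xpart-comb B c f0 = refl
  Xpart-comb B c f1 = refl
  Xpart-comb B c f2 = refl

  IsGraph : Mat3 → Vec 6 → Set
  IsGraph B v = Xpart v ≋ Ypart v ·M B

  ∈graph⇒IsGraph : ∀ B v → ⟪ graph B ⟫ v → IsGraph B v
  ∈graph⇒IsGraph B v (c , c≡v) k = begin
    Xpart v k                                 ≡⟨ sym (c≡v (k ↑ˡ 3)) ⟩
    Xpart (comb c (Plane.basis (graph B))) k  ≡⟨ Xpart-comb B c k ⟩
    (c ·M B) k                                ≡⟨ ·M-congˡ B (λ j → trans (sym (·M-identityʳ c j)) (c≡v (3 ↑ʳ j))) k ⟩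
    (Ypart v ·M B) k                          ∎

  IsGraph⇒∈graph : ∀ B v → IsGraph B v → ⟪ graph B ⟫ v
  IsGraph⇒∈graph B v X≋YB = Ypart v , byHalves (λ k → trans (Xpart-comb B (Ypart v) k) (sym (X≋YB k))) (·M-identityʳ (Ypart v))

  join∈graph : ∀ B y → ⟪ graph B ⟫ (join (y ·M B) y)
  join∈graph B y = IsGraph⇒∈graph B _ (Xpart-join (y ·M B) y)

  graph-dependent : ∀ {B u v} → IsGraph B u → IsGraph B v → Dependent (Ypart u) (Ypart v) → Dependent u v
  graph-dependent {B} {u} {v} u∈B v∈B (a , b , ¬a≡b≡0 , Yab≋0) = a , b , ¬a≡b≡0 , byHalves onX Yab≋0
    where
    onX : ∀ (k : Fin 3) → a * u (k ↑ˡ 3) + b * v (k ↑ˡ 3) ≡ 0#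
    onX k = begin
      a * Xpart u k + b * Xpart v k                         ≡⟨ cong₂ (λ x y → a * x + b * y) (u∈B k) (v∈B k) ⟩
      lincomb a (Ypart u ·M B) b (Ypart v ·M B) k           ≡⟨ sym (·M-lincomb a (Ypart u) b (Ypart v) B k) ⟩
      (lincomb a (Ypart u) b (Ypart v) ·M B) k              ≡⟨ ·M-zeroˡ B Yab≋0 k ⟩
      0#                                                    ∎

  meetInAtMostPoint⇒distinct : ∀ B B′ → PlanesMeetInAtMostPoint (graph B) (graph B′) → ¬ SamePlane (graph B) (graph B′)
  meetInAtMostPoint⇒distinct B B′ atMostPoint same with atMostPoint u₀ u₁ (join∈graph B (I3 f0)) (proj₁ (same u₀) (join∈graph B (I3 f0)))
                                                                      (join∈graph B (I3 f1)) (proj₁ (same u₁) (join∈graph B (I3 f1)))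
    where
    u₀ = join (I3 f0 ·M B) (I3 f0)
    u₁ = join (I3 f1 ·M B) (I3 f1)
  ... | a , b , ¬a≡b≡0 , u₀u₁≋0 = ¬a≡b≡0
    ( trans (solve 2 (λ a b → a := a :* ₁ :+ b :* ₀) refl a b) (u₀u₁≋0 (3 ↑ʳ f0))
    , trans (solve 2 (λ a b → b := a :* ₀ :+ b :* ₁) refl a b) (u₀u₁≋0 (3 ↑ʳ f1)))

module Twisting (F : FiniteField) (A : LinAlg.Mat3 F) where
  open FieldArithmetic F
  open LinAlg F hiding (_^_)
  open Vectors F
  open ≡-Reasoning

  Twisted : Vec 3 → Vec 3 → Vec 3 → Set
  Twisted t t′ c = cross c t ≋ cross c t′ ·M A

  module _ {t t′ : Vec 3} where

    twisted-cong : ∀ {c c′} → c ≋ c′ → Twisted t t′ c → Twisted t t′ c′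
    twisted-cong {c} {c′} c≋c′ twisted j = begin
      cross c′ t j       ≡⟨ sym (cross-cong {c} {c′} {t} {t} c≋c′ (λ _ → refl) j) ⟩
      cross c t j        ≡⟨ twisted j ⟩
      (cross c t′ ·M A) j  ≡⟨ ·M-congˡ A (cross-cong {c} {c′} {t′} {t′} c≋c′ (λ _ → refl)) j ⟩
      (cross c′ t′ ·M A) j ∎

    twisted-lincomb : ∀ a u b v → Twisted t t′ u → Twisted t t′ v → Twisted t t′ (lincomb a u b v)
    twisted-lincomb a u b v u-twisted v-twisted j = begin
      cross (lincomb a u b v) t j                            ≡⟨ cross-lincombˡ a u b v t j ⟩
      a * cross u t j + b * cross v t j                      ≡⟨ cong₂ (λ x y → a * x + b * y) (u-twisted j) (v-twisted j) ⟩
      a * (cross u t′ ·M A) j + b * (cross v t′ ·M A) j      ≡⟨ sym (·M-lincomb a (cross u t′) b (cross v t′) A j) ⟩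
      (lincomb a (cross u t′) b (cross v t′) ·M A) j         ≡⟨ ·M-congˡ A (λ l → sym (cross-lincombˡ a u b v t′ l)) j ⟩
      (cross (lincomb a u b v) t′ ·M A) j                    ∎

    twisted-unscale : ∀ a w → a ≢ 0# → Twisted t t′ (a · w) → Twisted t t′ w
    twisted-unscale a w a≢0 twisted j = *-cancelˡ-≢0 a≢0 (begin
      a * cross w t j              ≡⟨ sym (cross-scaleˡ a w t j) ⟩
      cross (a · w) t j            ≡⟨ twisted j ⟩
      (cross (a · w) t′ ·M A) j    ≡⟨ ·M-congˡ A (cross-scaleˡ a w t′) j ⟩
      ((a · cross w t′) ·M A) j    ≡⟨ ·M-scale a (cross w t′) A j ⟩
      a * (cross w t′ ·M A) j      ∎)

    -- The plane spanned by u and v is the orthogonal complement of u × v (Cramer's rule).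
    twisted-span : ∀ u v → NonZero (cross u v) → Twisted t t′ u → Twisted t t′ v →
                   ∀ w → dot w (cross u v) ≡ 0# → Twisted t t′ w
    twisted-span u v u×v≢0 u-twisted v-twisted w w⊥u×v with nonZeroCoordinate (cross u v) u×v≢0
    ... | j , nⱼ≢0 = twisted-unscale (cross u v j) w nⱼ≢0
                       (twisted-cong w-in-span (twisted-lincomb _ u _ v u-twisted v-twisted))
      where
      w-in-span : lincomb (cross w v j) u (cross u w j) v ≋ cross u v j · w
      w-in-span l = sym (begin
        cross u v j * w l                                                      ≡⟨ cramer u v w j l ⟩
        cross w v j * u l + cross u w j * v l + dot w (cross u v) * unit j l   ≡⟨ cong (λ z → cross w v j * u l + cross u w j * v l + z * unit j l) w⊥u×v ⟩
        cross w v j * u l + cross u w j * v l + 0# * unit j l                  ≡⟨ cong (cross w v j * u l + cross u w j * v l +_) (zeroˡ _) ⟩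
        cross w v j * u l + cross u w j * v l + 0#                             ≡⟨ +-identityʳ _ ⟩
        cross w v j * u l + cross u w j * v l                                  ∎)

module SingerIntersections (F : FiniteField) (C : LinAlg.Mat3 F) (singer : LinAlg.SingerCycle F C) where
  open FieldArithmetic F
  open LinAlg F renaming (_^_ to _^ₘ_)
  open Vectors F
  open SingerCycleProperties F C singer
  open ≡-Reasoning

  module _ {k : ℕ} (0<k : 0 < k) (k<N : k < q²+q+1) {t t′ : Vec 3} (t≢0 : NonZero t) (t′≢0 : NonZero t′) where
    open Twisting F (C ^ₘ k)

    -- t′ = ρ t makes c × t an eigenvector of C^k with eigenvalue ρ⁻¹.
    parallel-twisted⇒cross≋0 : cross t t′ ≋ zeroV → ∀ c → Twisted t t′ c → cross c t ≋ zeroV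
    parallel-twisted⇒cross≋0 t×t′≋0 c c-twisted with isZero? (cross c t)
    ... | yes c×t≋0 = c×t≋0
    ... | no c×t≢0  = ⊥-elim (no-eigenvectors (cross c t) k (ρ ⁻¹[ ρ≢0 ]) c×t≢0 0<k k<N λ j →
        x*y≡a⇒y≡x⁻¹*a ρ≢0 (begin
          ρ * (cross c t ·M (C ^ₘ k)) j      ≡⟨ sym (·M-scale ρ (cross c t) (C ^ₘ k) j) ⟩
          ((ρ · cross c t) ·M (C ^ₘ k)) j    ≡⟨ ·M-congˡ (C ^ₘ k) ρc×t≋c×t′ j ⟩
          (cross c t′ ·M (C ^ₘ k)) j         ≡⟨ sym (c-twisted j) ⟩
          cross c t j                        ∎))
      where
      ρ = proj₁ (cross≋0⇒parallel t′ t t≢0 (cross≋0-sym t t′ t×t′≋0))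
      t′≋ρt = proj₂ (cross≋0⇒parallel t′ t t≢0 (cross≋0-sym t t′ t×t′≋0))
      ρ≢0 : ρ ≢ 0#
      ρ≢0 ρ≡0 = t′≢0 λ j → trans (t′≋ρt j) (trans (cong (_* t j) ρ≡0) (zeroˡ _))
      ρc×t≋c×t′ : ρ · cross c t ≋ cross c t′
      ρc×t≋c×t′ l = trans (sym (cross-scaleʳ ρ c t l)) (cross-cong {c} {c} (λ _ → refl) (λ l′ → sym (t′≋ρt l′)) l)

    no-twisted-plane-parallel : cross t t′ ≋ zeroV → ∀ u v → NonZero (cross u v) →
                                Twisted t t′ u → Twisted t t′ v → ⊥
    no-twisted-plane-parallel t×t′≋0 u v u×v≢0 u-twisted v-twisted = u×v≢0 (parallel-trans u v t≢0
      (parallel-twisted⇒cross≋0 t×t′≋0 u u-twisted) (parallel-twisted⇒cross≋0 t×t′≋0 v v-twisted))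

    -- With n = u × v and m = t × t′: if n × m is 0, or parallel to t′, then t or t′ lies in the
    -- plane ⟨u, v⟩ = n^⊥, which forces m = 0; otherwise x = (n × m) × t′ is an eigenvector of C^k.
    private
      module SkewCase (m≢0 : NonZero (cross t t′)) (u v : Vec 3) (n≢0 : NonZero (cross u v))
                      (u-twisted : Twisted t t′ u) (v-twisted : Twisted t t′ v) where
        n = cross u v
        m = cross t t′
        c = cross n m

        twisted : ∀ w → dot w n ≡ 0# → Twisted t t′ w
        twisted = twisted-span {t} {t′} u v n≢0 u-twisted v-twisted

        t⊥n⇒⊥ : dot t n ≡ 0# → ⊥
        t⊥n⇒⊥ t⊥n = m≢0 (·M-C^-trivialKernel m k (<q²+q+1⇒≤q³-1 k<N)
          λ j → trans (sym (twisted t t⊥n j)) (cross-self t j))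

        t′⊥n⇒⊥ : dot t′ n ≡ 0# → ⊥
        t′⊥n⇒⊥ t′⊥n = m≢0 (cross≋0-sym t′ t λ j → trans (twisted t′ t′⊥n j) (·M-zeroˡ (C ^ₘ k) (cross-self t′) j))

        contradiction : ⊥
        contradiction with isZero? c
        ... | yes c≋0 = t⊥n⇒⊥ (begin
              dot t n        ≡⟨ dot-comm t n ⟩
              dot n t        ≡⟨ dot-cong {n} {l · m} {t} {t} n≋lm (λ _ → refl) ⟩
              dot (l · m) t  ≡⟨ dot-scaleˡ l m t ⟩
              l * dot m t    ≡⟨ cong (l *_) (dot-crossˡ t t′) ⟩
              l * 0#         ≡⟨ zeroʳ l ⟩
              0#             ∎)
          where
          l = proj₁ (cross≋0⇒parallel n m m≢0 c≋0)
          n≋lm = proj₂ (cross≋0⇒parallel n m m≢0 c≋0)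
        ... | no c≢0 with isZero? (cross c t′)
        ...   | yes c×t′≋0 = t′⊥n⇒⊥ (x*y≡0⇒y≡0 l≢0 (begin
                l * dot t′ n   ≡⟨ sym (dot-scaleˡ l t′ n) ⟩
                dot (l · t′) n ≡⟨ sym (dot-cong {c} {l · t′} {n} {n} c≋lt′ (λ _ → refl)) ⟩
                dot c n        ≡⟨ dot-crossˡ n m ⟩
                0#             ∎))
          where
          l = proj₁ (cross≋0⇒parallel c t′ t′≢0 c×t′≋0)
          c≋lt′ = proj₂ (cross≋0⇒parallel c t′ t′≢0 c×t′≋0)
          l≢0 : l ≢ 0#
          l≢0 l≡0 = c≢0 λ j → trans (c≋lt′ j) (trans (cong (_* t′ j) l≡0) (zeroˡ _))
        ...   | no x≢0 = no-eigenvectors x k μ x≢0 0<k k<N xCᵏ≋μx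
          where
          x = cross c t′
          xCᵏ∥x : cross (x ·M (C ^ₘ k)) x ≋ zeroV
          xCᵏ∥x j = begin
            cross (x ·M (C ^ₘ k)) x j      ≡⟨ sym (cross-cong {cross c t} {x ·M (C ^ₘ k)} {x} {x} (twisted c (dot-crossˡ n m)) (λ _ → refl) j) ⟩
            cross (cross c t) x j          ≡⟨ cross-cross c t t′ j ⟩
            dot c m * c j                  ≡⟨ cong (_* c j) (dot-crossʳ n m) ⟩
            0# * c j                       ≡⟨ zeroˡ _ ⟩
            0#                             ∎
          μ = proj₁ (cross≋0⇒parallel (x ·M (C ^ₘ k)) x x≢0 xCᵏ∥x)
          xCᵏ≋μx = proj₂ (cross≋0⇒parallel (x ·M (C ^ₘ k)) x x≢0 xCᵏ∥x)

    no-twisted-plane-skew : NonZero (cross t t′) → ∀ u v → NonZero (cross u v) →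
                            Twisted t t′ u → Twisted t t′ v → ⊥
    no-twisted-plane-skew = SkewCase.contradiction

  no-twisted-plane : ∀ {k} → 0 < k → k < q²+q+1 → ∀ {t t′} → NonZero t → NonZero t′ → ∀ u v → NonZero (cross u v) →
                     let open Twisting F (C ^ₘ k) in Twisted t t′ u → Twisted t t′ v → ⊥
  no-twisted-plane 0<k k<N {t} {t′} t≢0 t′≢0 with isZero? (cross t t′)
  ... | yes t×t′≋0 = no-twisted-plane-parallel 0<k k<N t≢0 t′≢0 t×t′≋0
  ... | no t×t′≢0  = no-twisted-plane-skew 0<k k<N t≢0 t′≢0 t×t′≢0

module SingerPlanes (F : FiniteField) (C : LinAlg.Mat3 F) (singer : LinAlg.SingerCycle F C) where
  open FieldArithmetic F
  open LinAlg F renaming (_^_ to _^ₘ_)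
  open Vectors F
  open Matrices F
  open Enumeration F
  open MatrixPowers F
  open GraphPlanes F
  open SingerCycleProperties F C singer
  open SingerIntersections F C singer
  open ≡-Reasoning

  C⁻ : ℕ → Mat3
  C⁻ i = C ^ₘ (q³-1 ∸ i)

  -- W(i, t) = {(y S_t C^{-i}, y)}, i.e. X C^i = Y × t, where S_t is the matrix of y ↦ y × t.
  slope : ℕ → Triple → Mat3
  slope i t = skew (toVec t) ⊗ C⁻ i

  plane : ℕ × Triple → Plane
  plane (i , t) = graph (slope i t)

  ·M-C⁻-C^ : ∀ (z : Vec 3) i k → i ≤ q³-1 → (z ·M C⁻ i) ·M (C ^ₘ (i ℕ.+ k)) ≋ z ·M (C ^ₘ k)
  ·M-C⁻-C^ z i k i≤ j = begin
    ((z ·M C⁻ i) ·M (C ^ₘ (i ℕ.+ k))) j          ≡⟨ sym (·M-^-+ C z (q³-1 ∸ i) (i ℕ.+ k) j) ⟩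
    (z ·M (C ^ₘ ((q³-1 ∸ i) ℕ.+ (i ℕ.+ k)))) j   ≡⟨ cong (λ e → (z ·M (C ^ₘ e)) j) exponent ⟩
    (z ·M (C ^ₘ (q³-1 ℕ.+ k))) j                 ≡⟨ ·M-^-+ C z q³-1 k j ⟩
    ((z ·M (C ^ₘ q³-1)) ·M (C ^ₘ k)) j           ≡⟨ ·M-congˡ (C ^ₘ k) (·M-C^[q³-1] z) j ⟩
    (z ·M (C ^ₘ k)) j                            ∎
    where
    exponent : (q³-1 ∸ i) ℕ.+ (i ℕ.+ k) ≡ q³-1 ℕ.+ k
    exponent = trans (sym (ℕ.+-assoc (q³-1 ∸ i) i k)) (cong (ℕ._+ k) (ℕ.m∸n+n≡m i≤))

  ·M-C^-C⁻ : ∀ (z : Vec 3) i → i ≤ q³-1 → (z ·M (C ^ₘ i)) ·M C⁻ i ≋ z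
  ·M-C^-C⁻ z i i≤ j = begin
    ((z ·M (C ^ₘ i)) ·M C⁻ i) j            ≡⟨ sym (·M-^-+ C z i (q³-1 ∸ i) j) ⟩
    (z ·M (C ^ₘ (i ℕ.+ (q³-1 ∸ i)))) j     ≡⟨ cong (λ e → (z ·M (C ^ₘ e)) j) (ℕ.m+[n∸m]≡n i≤) ⟩
    (z ·M (C ^ₘ q³-1)) j                   ≡⟨ ·M-C^[q³-1] z j ⟩
    z j                                    ∎

  ·M-slope-C^ : ∀ (y : Vec 3) i t k → i ≤ q³-1 → (y ·M slope i t) ·M (C ^ₘ (i ℕ.+ k)) ≋ cross y (toVec t) ·M (C ^ₘ k)
  ·M-slope-C^ y i t k i≤ j = begin
    ((y ·M slope i t) ·M (C ^ₘ (i ℕ.+ k))) j                   ≡⟨ ·M-congˡ (C ^ₘ (i ℕ.+ k)) (λ l → sym (·M-assoc y (skew (toVec t)) (C⁻ i) l)) j ⟩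
    (((y ·M skew (toVec t)) ·M C⁻ i) ·M (C ^ₘ (i ℕ.+ k))) j    ≡⟨ ·M-C⁻-C^ (y ·M skew (toVec t)) i k i≤ j ⟩
    ((y ·M skew (toVec t)) ·M (C ^ₘ k)) j                      ≡⟨ ·M-congˡ (C ^ₘ k) (·M-skew y (toVec t)) j ⟩
    (cross y (toVec t) ·M (C ^ₘ k)) j                          ∎

  ·M-slope-C^i : ∀ (y : Vec 3) i t → i ≤ q³-1 → (y ·M slope i t) ·M (C ^ₘ i) ≋ cross y (toVec t)
  ·M-slope-C^i y i t i≤ j = begin
    ((y ·M slope i t) ·M (C ^ₘ i)) j           ≡⟨ cong (λ e → ((y ·M slope i t) ·M (C ^ₘ e)) j) (sym (ℕ.+-identityʳ i)) ⟩
    ((y ·M slope i t) ·M (C ^ₘ (i ℕ.+ 0))) j   ≡⟨ ·M-slope-C^ y i t 0 i≤ j ⟩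
    (cross y (toVec t) ·M I3) j                ≡⟨ ·M-identityʳ (cross y (toVec t)) j ⟩
    cross y (toVec t) j                        ∎

  Qform≡dot : ∀ i (v : Vec 6) → Qform C i v ≡ dot (Xpart v ·M (C ^ₘ i)) (Ypart v)
  Qform≡dot i v = solve 15 (λ x0 x1 x2 a b c d e f g h i y0 y1 y2 →
      let X = vec x0 x1 x2 ; M = mat a b c d e f g h i ; Y = vec y0 y1 y2 in
      ℙ.Σ₃ (λ j → ℙ.Σ₃ (λ k → X j :* M j k :* Y k)) := ℙ.dot (X ℙ.⋆ M) Y)
    refl (Xpart v f0) (Xpart v f1) (Xpart v f2) (P f0 f0) (P f0 f1) (P f0 f2) (P f1 f0) (P f1 f1) (P f1 f2)
         (P f2 f0) (P f2 f1) (P f2 f2) (Ypart v f0) (Ypart v f1) (Ypart v f2)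
    where P = C ^ₘ i

  module _ {i} (i<N : i < q²+q+1) {t} (t≢0 : t ≢ 0₃) where
    private
      i≤ : i ≤ q³-1
      i≤ = <q²+q+1⇒≤q³-1 i<N
      B = slope i t
      W = ⟪ plane (i , t) ⟫
      τ≢0 = toVec-nonZero t t≢0

    X[C^i]≋Y×t : ∀ v → W v → Xpart v ·M (C ^ₘ i) ≋ cross (Ypart v) (toVec t)
    X[C^i]≋Y×t v v∈W j = trans (·M-congˡ (C ^ₘ i) (∈graph⇒IsGraph B v v∈W) j) (·M-slope-C^i (Ypart v) i t i≤ j)

    plane-inQuadric : InQuadric C i W
    plane-inQuadric v v∈W = begin
      Qform C i v                              ≡⟨ Qform≡dot i v ⟩
      dot (Xpart v ·M (C ^ₘ i)) (Ypart v)      ≡⟨ dot-cong {Xpart v ·M (C ^ₘ i)} {cross (Ypart v) (toVec t)} {Ypart v} {Ypart v} (X[C^i]≋Y×t v v∈W) (λ _ → refl) ⟩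
      dot (cross (Ypart v) (toVec t)) (Ypart v) ≡⟨ dot-crossˡ (Ypart v) (toVec t) ⟩
      0#                                       ∎

    ∈π₁⇒Y∥t : ∀ v → W v → π₁ v → cross (Ypart v) (toVec t) ≋ zeroV
    ∈π₁⇒Y∥t v v∈W v∈π₁ j = trans (sym (X[C^i]≋Y×t v v∈W j)) (·M-zeroˡ (C ^ₘ i) v∈π₁ j)

    plane-meets-π₁ : ExactlyPoint W π₁
    plane-meets-π₁ = (join zeroV (toVec t) , ⟨0,t⟩∈W , Xpart-join zeroV (toVec t) , λ z → τ≢0 (λ j → z (3 ↑ʳ j)))
                   , λ u v u∈W u∈π₁ v∈W v∈π₁ → graph-dependent {B} (∈graph⇒IsGraph B u u∈W) (∈graph⇒IsGraph B v v∈W)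
                       (cross≋0⇒dependent (Ypart u) (Ypart v) (parallel-trans (Ypart u) (Ypart v) τ≢0 (∈π₁⇒Y∥t u u∈W u∈π₁) (∈π₁⇒Y∥t v v∈W v∈π₁)))
      where
      ⟨0,t⟩∈W : W (join zeroV (toVec t))
      ⟨0,t⟩∈W = IsGraph⇒∈graph B _ λ k → trans (Xpart-join zeroV (toVec t) k) (sym (begin
        (toVec t ·M B) k                                 ≡⟨ sym (·M-assoc (toVec t) (skew (toVec t)) (C⁻ i) k) ⟩
        ((toVec t ·M skew (toVec t)) ·M C⁻ i) k           ≡⟨ ·M-zeroˡ (C⁻ i) (λ l → trans (·M-skew (toVec t) (toVec t) l) (cross-self (toVec t) l)) k ⟩
        0#                                               ∎))

    -- All of π₁ in W would make both e₀ and e₁ parallel to t, but e₀ × e₁ = e₂.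
    plane≢π₁ : ¬ (W ≐ π₁)
    plane≢π₁ W≐π₁ = 1≢0 (trans (solve 0 (₁ := ₁ :* ₁ :+ :- (₀ :* ₀)) refl) (parallel-trans (I3 f0) (I3 f1) τ≢0 (e∥t f0) (e∥t f1) f2))
      where
      e∥t : ∀ j → cross (I3 j) (toVec t) ≋ zeroV
      e∥t j = ∈π₁⇒Y∥t _ (join∈graph B (I3 j)) (proj₁ (W≐π₁ _) (join∈graph B (I3 j)))

    plane-disjoint-π₂ : Disjoint W π₂
    plane-disjoint-π₂ v v∈W v∈π₂ = byHalves (λ k → trans (∈graph⇒IsGraph B v v∈W k) (·M-zeroˡ B v∈π₂ k)) v∈π₂

    plane∈𝒢 : InG C i (plane (i , t))
    plane∈𝒢 = plane-inQuadric , inj₂ plane-meets-π₁ , plane≢π₁ , plane-disjoint-π₂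

  -- W is disjoint from π₂, so it is the graph of some B; lying on 𝒬_i makes B C^i alternating, i.e. B = S_t C^{-i}.
  module _ {i} (i<N : i < q²+q+1) (W : Plane) (W∈𝒢 : InG C i W) where
    private
      i≤ : i ≤ q³-1
      i≤ = <q²+q+1⇒≤q³-1 i<N
      b = Plane.basis W
      inQuadric = proj₁ W∈𝒢
      W≢π₁ = proj₁ (proj₂ (proj₂ W∈𝒢))
      disjoint = proj₂ (proj₂ (proj₂ W∈𝒢))

      Xm Ym : Mat3
      Xm j k = b j (k ↑ˡ 3)
      Ym j k = b j (3 ↑ʳ k)

      Ym-invertible : Invertible Ym
      Ym-invertible = trivialKernel⇒invertible Ym λ c cYm≋0 → Plane.independent W c (disjoint (comb c b) (c , λ _ → refl) cYm≋0)

      Ym⁻¹ = proj₁ Ym-invertible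
      B = Ym⁻¹ ⊗ Xm
      G = B ⊗ (C ^ₘ i)

      W⇒IsGraph : ∀ v → ⟪ W ⟫ v → IsGraph B v
      W⇒IsGraph v (c , c≡v) k = sym (begin
        (Ypart v ·M B) k              ≡⟨ ·M-congˡ B (λ l → sym (c≡v (3 ↑ʳ l))) k ⟩
        ((c ·M Ym) ·M (Ym⁻¹ ⊗ Xm)) k  ≡⟨ sym (·M-assoc (c ·M Ym) Ym⁻¹ Xm k) ⟩
        (((c ·M Ym) ·M Ym⁻¹) ·M Xm) k ≡⟨ ·M-congˡ Xm (proj₁ (proj₂ Ym-invertible) c) k ⟩
        (c ·M Xm) k                   ≡⟨ c≡v (k ↑ˡ 3) ⟩
        Xpart v k                     ∎)

      IsGraph⇒W : ∀ v → IsGraph B v → ⟪ W ⟫ v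
      IsGraph⇒W v X≋YB = Ypart v ·M Ym⁻¹ , byHalves {P = λ m → comb (Ypart v ·M Ym⁻¹) b m ≡ v m}
        (λ k → trans (·M-assoc (Ypart v) Ym⁻¹ Xm k) (sym (X≋YB k))) (proj₂ (proj₂ Ym-invertible) (Ypart v))

      G-alternating : ∀ y → dot (y ·M G) y ≡ 0#
      G-alternating y = begin
        dot (y ·M G) y                        ≡⟨ dot-cong {y ·M G} {Xpart w ·M (C ^ₘ i)} {y} {y} yG≋ (λ _ → refl) ⟩
        dot (Xpart w ·M (C ^ₘ i)) (Ypart w)   ≡⟨ sym (Qform≡dot i w) ⟩
        Qform C i w                           ≡⟨ inQuadric w (IsGraph⇒W w (Xpart-join (y ·M B) y)) ⟩
        0#                                    ∎
        where
        w = join (y ·M B) y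
        yG≋ : y ·M G ≋ Xpart w ·M (C ^ₘ i)
        yG≋ k = trans (sym (·M-assoc y B (C ^ₘ i) k)) (·M-congˡ (C ^ₘ i) (λ l → sym (Xpart-join (y ·M B) y l)) k)

      t : Triple
      t = G f2 f1 , G f0 f2 , G f1 f0

      ·M-slope≋·M-B : ∀ y → y ·M slope i t ≋ y ·M B
      ·M-slope≋·M-B y k = begin
        (y ·M slope i t) k                  ≡⟨ sym (·M-assoc y (skew (toVec t)) (C⁻ i) k) ⟩
        ((y ·M skew (toVec t)) ·M C⁻ i) k   ≡⟨ ·M-congˡ (C⁻ i) (·M-congʳ y (λ j l → sym (alternating⇒skew G G-alternating j l))) k ⟩
        ((y ·M G) ·M C⁻ i) k                ≡⟨ ·M-congˡ (C⁻ i) (λ l → sym (·M-assoc y B (C ^ₘ i) l)) k ⟩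
        (((y ·M B) ·M (C ^ₘ i)) ·M C⁻ i) k  ≡⟨ ·M-C^-C⁻ (y ·M B) i i≤ k ⟩
        (y ·M B) k                          ∎

      W≐plane : SamePlane W (plane (i , t))
      W≐plane v = (λ v∈W → IsGraph⇒∈graph (slope i t) v λ k → trans (W⇒IsGraph v v∈W k) (sym (·M-slope≋·M-B (Ypart v) k)))
                , (λ v∈plane → IsGraph⇒W v λ k → trans (∈graph⇒IsGraph (slope i t) v v∈plane k) (·M-slope≋·M-B (Ypart v) k))

      t≢0 : t ≢ 0₃
      t≢0 t≡0 = W≢π₁ λ v → (λ v∈W k → trans (W⇒IsGraph v v∈W k) (·M-B≋0 (Ypart v) k))
                           , (λ v∈π₁ → IsGraph⇒W v λ k → trans (v∈π₁ k) (sym (·M-B≋0 (Ypart v) k)))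
        where
        ·M-B≋0 : ∀ y → y ·M B ≋ zeroV
        ·M-B≋0 y k = begin
          (y ·M B) k                           ≡⟨ sym (·M-slope≋·M-B y k) ⟩
          (y ·M slope i t) k                   ≡⟨ sym (·M-assoc y (skew (toVec t)) (C⁻ i) k) ⟩
          ((y ·M skew (toVec t)) ·M C⁻ i) k    ≡⟨ ·M-zeroˡ (C⁻ i) (λ l → trans (·M-skew y (toVec t) l)
                                                   (cross-zeroʳ y (λ j → trans (cong (λ s → toVec s j) t≡0) (vec-η zeroV j)) l)) k ⟩
          0#                                   ∎

    𝒢⇒plane : Σ Triple λ t → t ≢ 0₃ × SamePlane W (plane (i , t))
    𝒢⇒plane = t , t≢0 , W≐plane

  ValidIndex : ℕ × Triple → Set
  ValidIndex (i , t) = i < q²+q+1 × t ≢ 0₃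

  common-twisted : ∀ (c : Vec 3) i t i′ t′ → i ≤ i′ → i′ ≤ q³-1 →
                   c ·M slope i t ≋ c ·M slope i′ t′ → Twisting.Twisted F (C ^ₘ (i′ ∸ i)) (toVec t′) (toVec t) c
  common-twisted c i t i′ t′ i≤i′ i′≤ same j = begin
    cross c (toVec t′) j                                   ≡⟨ sym (·M-slope-C^i c i′ t′ i′≤ j) ⟩
    ((c ·M slope i′ t′) ·M (C ^ₘ i′)) j                    ≡⟨ ·M-congˡ (C ^ₘ i′) (λ l → sym (same l)) j ⟩
    ((c ·M slope i t) ·M (C ^ₘ i′)) j                      ≡⟨ cong (λ e → ((c ·M slope i t) ·M (C ^ₘ e)) j) (sym (ℕ.m+[n∸m]≡n i≤i′)) ⟩
    ((c ·M slope i t) ·M (C ^ₘ (i ℕ.+ (i′ ∸ i)))) j        ≡⟨ ·M-slope-C^ c i t (i′ ∸ i) (ℕ.≤-trans i≤i′ i′≤) j ⟩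
    (cross c (toVec t) ·M (C ^ₘ (i′ ∸ i))) j               ∎

  -- Two vectors y with y B = y B′ for distinct slopes B, B′ are parallel: for equal i they are
  -- parallel to t - t′, otherwise the plane they span would be twisted by C^|i - i′|.
  common-parallel : ∀ i t i′ t′ → ValidIndex (i , t) → ValidIndex (i′ , t′) → (i , t) ≢ (i′ , t′) →
                    ∀ (y z : Vec 3) → y ·M slope i t ≋ y ·M slope i′ t′ → z ·M slope i t ≋ z ·M slope i′ t′ →
                    cross y z ≋ zeroV
  common-parallel i t i′ t′ (i<N , t≢0) (i′<N , t′≢0) distinct y z y-same z-same with isZero? (cross y z)
  ... | yes y×z≋0 = y×z≋0
  ... | no y×z≢0 with ℕ.<-cmp i i′
  ...   | tri< i<i′ _ _ = ⊥-elim (no-twisted-plane (ℕ.m<n⇒0<n∸m i<i′) (ℕ.≤-<-trans (ℕ.m∸n≤m i′ i) i′<N)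
            (toVec-nonZero t′ t′≢0) (toVec-nonZero t t≢0) y z y×z≢0
            (common-twisted y i t i′ t′ (ℕ.<⇒≤ i<i′) (<q²+q+1⇒≤q³-1 i′<N) y-same)
            (common-twisted z i t i′ t′ (ℕ.<⇒≤ i<i′) (<q²+q+1⇒≤q³-1 i′<N) z-same))
  ...   | tri> _ _ i′<i = ⊥-elim (no-twisted-plane (ℕ.m<n⇒0<n∸m i′<i) (ℕ.≤-<-trans (ℕ.m∸n≤m i i′) i<N)
            (toVec-nonZero t t≢0) (toVec-nonZero t′ t′≢0) y z y×z≢0
            (common-twisted y i′ t′ i t (ℕ.<⇒≤ i′<i) (<q²+q+1⇒≤q³-1 i<N) (λ l → sym (y-same l)))
            (common-twisted z i′ t′ i t (ℕ.<⇒≤ i′<i) (<q²+q+1⇒≤q³-1 i<N) (λ l → sym (z-same l))))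
  ...   | tri≈ _ refl _ = parallel-trans y z d≢0 (×d≋0 y y-same) (×d≋0 z z-same)
    where
    d = lincomb 1# (toVec t) (- 1#) (toVec t′)
    ×d≋0 : ∀ c → c ·M slope i t ≋ c ·M slope i t′ → cross c d ≋ zeroV
    ×d≋0 c same j = begin
      cross c d j                                                ≡⟨ cross-lincombʳ c 1# (toVec t) (- 1#) (toVec t′) j ⟩
      1# * cross c (toVec t) j + - 1# * cross c (toVec t′) j     ≡⟨ cong (λ z → 1# * z + - 1# * cross c (toVec t′) j) c×t≡c×t′ ⟩
      1# * cross c (toVec t′) j + - 1# * cross c (toVec t′) j    ≡⟨ solve 1 (λ x → ₁ :* x :+ :- ₁ :* x := ₀) refl (cross c (toVec t′) j) ⟩
      0#                                                         ∎
      where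
      c×t≡c×t′ : cross c (toVec t) j ≡ cross c (toVec t′) j
      c×t≡c×t′ = trans (sym (·M-slope-C^i c i t (<q²+q+1⇒≤q³-1 i<N) j))
                   (trans (·M-congˡ (C ^ₘ i) same j) (·M-slope-C^i c i t′ (<q²+q+1⇒≤q³-1 i<N) j))
    d≢0 : NonZero d
    d≢0 d≋0 = distinct (cong (i ,_) (toVec-injective t t′ λ j → x-y≡0⇒x≡y
      (trans (solve 2 (λ a b → a :+ :- b := ₁ :* a :+ :- ₁ :* b) refl (toVec t j) (toVec t′ j)) (d≋0 j))))

  planes-meet-in-at-most-point : ∀ a b → ValidIndex a → ValidIndex b → a ≢ b → PlanesMeetInAtMostPoint (plane a) (plane b)
  planes-meet-in-at-most-point (i , t) (i′ , t′) valid valid′ distinct u v u∈W u∈W′ v∈W v∈W′ =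
    graph-dependent {slope i t} (∈graph⇒IsGraph (slope i t) u u∈W) (∈graph⇒IsGraph (slope i t) v v∈W)
      (cross≋0⇒dependent (Ypart u) (Ypart v)
        (common-parallel i t i′ t′ valid valid′ distinct (Ypart u) (Ypart v) (same u u∈W u∈W′) (same v v∈W v∈W′)))
    where
    same : ∀ w → ⟪ plane (i , t) ⟫ w → ⟪ plane (i′ , t′) ⟫ w → Ypart w ·M slope i t ≋ Ypart w ·M slope i′ t′
    same w w∈W w∈W′ k = trans (sym (∈graph⇒IsGraph (slope i t) w w∈W k)) (∈graph⇒IsGraph (slope i′ t′) w w∈W′ k)

  distinct-planes : ∀ a b → ValidIndex a → ValidIndex b → a ≢ b →
                    ¬ SamePlane (plane a) (plane b) × PlanesMeetInAtMostPoint (plane a) (plane b)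
  distinct-planes a@(i , t) b@(i′ , t′) valid valid′ distinct =
    meetInAtMostPoint⇒distinct (slope i t) (slope i′ t′) atMostPoint , atMostPoint
    where atMostPoint = planes-meet-in-at-most-point a b valid valid′ distinct

open import Data.Nat using (_+_; _*_; _^_)

mainTheorem11 : (F : FiniteField) →
    (C : LinAlg.Mat3 F) → LinAlg.SingerCycle F C →
    Σ (List (LinAlg.Plane F)) (λ 𝒞 →
      -- 𝒞 has exactly (q^3-1)(q^2+q+1) pairwise distinct planes
      (length 𝒞 ≡ (LinAlg.q F ^ 3 ∸ 1) * (LinAlg.q F ^ 2 + LinAlg.q F + 1)) ×
      -- every plane listed lies in the union of 𝒢_i for 0 ≤ i ≤ q^2+q
      All (λ W → Σ ℕ (λ i → (i < LinAlg.q F ^ 2 + LinAlg.q F + 1) × LinAlg.InG F C i W)) 𝒞 ×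
      -- every plane of that union is listed
      (∀ i W → i < LinAlg.q F ^ 2 + LinAlg.q F + 1 → LinAlg.InG F C i W →
        Σ (LinAlg.Plane F) (λ W′ → (W′ ∈ 𝒞) × LinAlg.SamePlane F W W′)) ×
      -- listed planes are pairwise distinct and meet in at most a point
      AllPairs (λ U W → ¬ LinAlg.SamePlane F U W × LinAlg.PlanesMeetInAtMostPoint F U W) 𝒞)
mainTheorem11 F C singer = map plane indices , length-𝒞 , All.map⁺ (All.map in𝒢 valid) , listed , pairwise
  where
  open Enumeration F
  open SingerCycleProperties F C singer
  open SingerPlanes F C singer
  open Counting

  indices : List (ℕ × Triple)
  indices = cartesianProduct (upTo q²+q+1) nonzeroTriples

  valid : All ValidIndex indices
  valid = All.tabulate λ i∈ → let (i∈upTo , t∈) = ∈.∈-cartesianProduct⁻ (upTo q²+q+1) nonzeroTriples i∈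
                              in ∈.∈-upTo⁻ i∈upTo , ∈-nonzeroTriples⁻ t∈

  length-𝒞 : length (map plane indices) ≡ q³-1 * q²+q+1
  length-𝒞 = trans (List.length-map plane indices) (trans (length-cartesianProduct (upTo q²+q+1) nonzeroTriples)
    (trans (cong₂ _*_ (List.length-upTo q²+q+1) length-nonzeroTriples) (ℕ.*-comm q²+q+1 q³-1)))

  in𝒢 : ∀ {a} → ValidIndex a → Σ ℕ λ i → i < q²+q+1 × LinAlg.InG F C i (plane a)
  in𝒢 {i , t} (i<N , t≢0) = i , i<N , plane∈𝒢 i<N t≢0

  listed : ∀ i W → i < q²+q+1 → LinAlg.InG F C i W → Σ (LinAlg.Plane F) λ W′ → W′ ∈ map plane indices × LinAlg.SamePlane F W W′
  listed i W i<N W∈𝒢 = let (t , t≢0 , W≐) = 𝒢⇒plane i<N W W∈𝒢 in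
    plane (i , t) , ∈.∈-map⁺ plane (∈.∈-cartesianProduct⁺ (∈.∈-upTo⁺ i<N) (∈-nonzeroTriples⁺ t t≢0)) , W≐

  pairwise : AllPairs (λ U W → ¬ LinAlg.SamePlane F U W × LinAlg.PlanesMeetInAtMostPoint F U W) (map plane indices)
  pairwise = AllPairs.map⁺ (AllPairs-≢⇒ (λ {a} {b} → distinct-planes a b)
    (Unique.cartesianProduct⁺ (Unique.upTo⁺ q²+q+1) unique-nonzeroTriples) valid)
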